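{- Let $q$ be a prime power. The group $G(\mathcal O)$ acts generously transitively on the set $\mathcal L_+$ of secant lines of $\mathcal O$ in $\mathrm{PG}(2,q)$. It also acts generously transitively on the set $\mathcal L_-$ of exterior lines of $\mathcal O$ in $\mathrm{PG}(2,q)$.
   Context: Let $q$ be a prime power. - $\mathcal O=\{(\xi,\xi^2,1)^\top:\xi\in\mathbb F_q\}\cup\{(0,1,0)^\top\}$ is a conic in $\mathrm{PG}(2,q)$; points are nonzero column vectors up to scalars. - A secant (resp. exterior) line is a line meeting $\mathcal O$ in $2$ (resp. $0$) points. - $G(\mathcal O)$ is the image of $\mathrm{PGL}(2,q)$ in $\mathrm{PGL}(3,q)$ under $$\begin{pmatrix}a&b\\c&d\end{pmatrix}\mapsto\begin{pmatrix}ad+bc&ac&bd\\2ab&a^2&b^2\\2cd&c^2&d^2\end{pmatrix},$$ which is the setwise stabilizer of $\mathcal O$ in $\mathrm{PGL}(3,q)$. - A group $G$ acts generously transitively on $X$ if for all $x,y\in X$ there is $g\in G$ with $g(x)=y$ and $g(y)=x$. -}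

module Defs where

open import Level using (0ℓ)
open import Data.Nat as ℕ using (ℕ)
open import Data.Nat.Primality using (Prime)
open import Data.Fin using (Fin)
open import Data.Product using (Σ; ∃; ∃-syntax; _×_; _,_)
open import Data.Sum using (_⊎_)
open import Relation.Nullary using (¬_)
open import Relation.Binary.PropositionalEquality using (_≡_; _≢_)
open import Function.Bundles using (_↔_)
open import Algebra.Structures using (IsCommutativeRing)

IsPrimePower : ℕ → Set
IsPrimePower q = Σ ℕ λ p → Σ ℕ λ k → Prime p × q ≡ p ℕ.^ ℕ.suc k

record FiniteField (q : ℕ) : Set₁ where
  infixl 7 _*_
  infixl 6 _+_
  field
    Carrier : Set
    _+_ _*_ : Carrier → Carrier → Carrier
    -_ : Carrier → Carrier
    0# 1# : Carrier
    isCommutativeRing : IsCommutativeRing _≡_ _+_ _*_ -_ 0# 1#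
    0≢1 : 0# ≢ 1#
    inverse : ∀ x → x ≢ 0# → Σ Carrier λ y → x * y ≡ 1#
    enumeration : Fin q ↔ Carrier

module Plane {q : ℕ} (F : FiniteField q) where
  open FiniteField F

  -- coordinate vectors in F^3 (column vectors for points, row vectors for lines)
  record V3 : Set where
    constructor v3
    field
      c₁ c₂ c₃ : Carrier
  open V3 public

  NonZero : V3 → Set
  NonZero v = ¬ (c₁ v ≡ 0# × c₂ v ≡ 0# × c₃ v ≡ 0#)

  scale : Carrier → V3 → V3
  scale λ' (v3 x y z) = v3 (λ' * x) (λ' * y) (λ' * z)

  -- u and v represent the same projective point (or the same line)
  Proportional : V3 → V3 → Set
  Proportional u v = Σ Carrier λ λ' → λ' ≢ 0# × v ≡ scale λ' u

  dot : V3 → V3 → Carrier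
  dot (v3 a b c) (v3 x y z) = a * x + b * y + c * z

  -- a point of PG(2,q) is a nonzero vector x (up to scalars); a line of PG(2,q) is
  -- a nonzero (dual) vector u (up to scalars); incidence: u · x = 0.
  IsPoint : V3 → Set
  IsPoint = NonZero

  IsLine : V3 → Set
  IsLine = NonZero

  Incident : V3 → V3 → Set
  Incident u x = dot u x ≡ 0#

  InConic : V3 → Set
  InConic x = (Σ Carrier λ ξ → Proportional (v3 ξ (ξ * ξ) 1#) x)
            ⊎ Proportional (v3 0# 1# 0#) x

  Secant : V3 → Set
  Secant u = IsLine u ×
    Σ V3 λ x → Σ V3 λ y →
      IsPoint x × IsPoint y × InConic x × InConic y ×
      Incident u x × Incident u y × ¬ Proportional x y ×
      (∀ z → IsPoint z → InConic z → Incident u z → Proportional x z ⊎ Proportional y z)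

  Exterior : V3 → Set
  Exterior u = IsLine u × (∀ z → IsPoint z → InConic z → ¬ Incident u z)

  two : Carrier
  two = 1# + 1#

  -- the 3×3 matrix image of (a b; c d) ∈ PGL(2,q), applied to a column vector
  ρ : Carrier → Carrier → Carrier → Carrier → V3 → V3
  ρ a b c d (v3 x y z) =
    v3 ((a * d + b * c) * x + (a * c) * y + (b * d) * z)
       ((two * a * b) * x + (a * a) * y + (b * b) * z)
       ((two * c * d) * x + (c * c) * y + (d * d) * z)

  det2 : Carrier → Carrier → Carrier → Carrier → Carrier
  det2 a b c d = a * d + - (b * c)

  MapsLine : (V3 → V3) → V3 → V3 → Set
  MapsLine M u v = ∀ x → IsPoint x →
    (Incident u x → Incident v (M x)) × (Incident v (M x) → Incident u x)

  GenerouslyTransitiveOnLines : (V3 → Set) → Set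
  GenerouslyTransitiveOnLines P = ∀ u v → P u → P v →
    Σ Carrier λ a → Σ Carrier λ b → Σ Carrier λ c → Σ Carrier λ d →
      det2 a b c d ≢ 0# × MapsLine (ρ a b c d) u v × MapsLine (ρ a b c d) v u

-- PGL(2,q) acts on lines through the transpose of ρ.  This turns a line u into the binary
-- quadratic form u₁ s t + u₂ s² + u₃ t², which vanishes exactly at the parameters (s : t) of the
-- conic points (s t : s² : t²) on u, and turns the action into linear substitution.  If u ∼ N·Bu
-- and v ∼ N·Bv lie in the orbit of a line N and S stabilises N with T S of trace zero, where
-- T = Bu Bv⁻¹, then (T S)² is scalar and Bv⁻¹ S Bu interchanges u and v.  Such an S exists when
-- N is x₁ = 0, whose stabiliser contains the diagonal and antidiagonal matrices, and when N is
-- the norm form of a quadratic extension, whose stabiliser contains its multiplications.  Every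
-- secant line lies in the orbit of x₁ = 0.  An exterior line is an anisotropic form; it is
-- equivalent to s² - d t² with d a nonsquare when q is odd, and to s t + s² + c t² with c outside
-- {z² + z} when q is even.  Any two such normal forms are equivalent, because the product of two
-- nonsquares is a square and {z² + z} has index 2 in (F, +).

module Submission where

open import Level using (0ℓ)
open import Data.Nat as ℕ using (ℕ; zero; suc)
import Data.Nat.Properties as ℕ
open import Data.Integer as ℤ using (ℤ; -[1+_]; _⊖_; _◃_)
import Data.Integer.Properties as ℤ
import Data.Sign as Sign
open import Data.Fin as Fin using (Fin; toℕ; punchOut)
import Data.Fin.Properties as Fin
open import Data.Maybe using (just; nothing)
open import Data.Product using (Σ; ∃; _×_; _,_; proj₁; proj₂)
open import Data.Sum using (_⊎_; inj₁; inj₂)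
open import Data.Empty using (⊥-elim)
open import Relation.Nullary using (Dec; yes; no; ¬_)
import Relation.Nullary.Decidable as Dec
open import Relation.Binary.PropositionalEquality using (_≡_; _≢_; refl; sym; trans; cong; cong₂; subst; module ≡-Reasoning)
open import Relation.Binary.Definitions using (WeaklyDecidable; DecidableEquality)
open import Function.Bundles using (_↔_; Inverse)
open import Algebra.Bundles using (CommutativeRing)
import Algebra.Solver.Ring
import Algebra.Solver.Ring.AlmostCommutativeRing as AlmostCommutativeRing
import Algebra.Properties.Ring
import Algebra.Properties.AbelianGroup
import Algebra.Properties.CommutativeSemigroup
import Algebra.Properties.Semiring.Mult.TCOptimised
import Relation.Binary.Reasoning.Setoid as SetoidReasoning
open import Relation.Binary.Bundles using (Setoid)
open import Defs

module IntegerCoefficients {c ℓ} (R : CommutativeRing c ℓ) where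
  open CommutativeRing R hiding (refl; sym; trans)
  open CommutativeRing R using () renaming (refl to ≈-refl; sym to ≈-sym; trans to ≈-trans)
  open Algebra.Properties.Ring ring using (-‿distribˡ-*; -‿distribʳ-*)
  open Algebra.Properties.AbelianGroup +-abelianGroup using (⁻¹-involutive; ε⁻¹≈ε; ⁻¹-∙-comm)
  open Algebra.Properties.CommutativeSemigroup +-commutativeSemigroup using (interchange)
  open Algebra.Properties.Semiring.Mult.TCOptimised semiring using (×-homo-+; ×1-homo-*) renaming (_×_ to _×ₙ_)
  open import Relation.Binary.Reasoning.Setoid setoid

  ⟦_⟧ᶻ : ℤ → Carrier
  ⟦ ℤ.+ n ⟧ᶻ = n ×ₙ 1#
  ⟦ -[1+ n ] ⟧ᶻ = - (suc n ×ₙ 1#)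

  private
    ⊖-homo : ∀ m n → ⟦ m ⊖ n ⟧ᶻ ≈ m ×ₙ 1# - n ×ₙ 1#
    ⊖-homo m zero = begin
      m ×ₙ 1#       ≈⟨ +-identityʳ _ ⟨
      m ×ₙ 1# + 0#  ≈⟨ +-congˡ ε⁻¹≈ε ⟨
      m ×ₙ 1# - 0#  ∎
    ⊖-homo zero (suc n) = ≈-sym (+-identityˡ _)
    ⊖-homo (suc m) (suc n) = begin
      ⟦ suc m ⊖ suc n ⟧ᶻ                 ≡⟨ cong ⟦_⟧ᶻ (ℤ.[1+m]⊖[1+n]≡m⊖n m n) ⟩
      ⟦ m ⊖ n ⟧ᶻ                         ≈⟨ ⊖-homo m n ⟩
      m ×ₙ 1# - n ×ₙ 1#                  ≈⟨ +-identityˡ _ ⟨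
      0# + (m ×ₙ 1# - n ×ₙ 1#)           ≈⟨ +-congʳ (-‿inverseʳ 1#) ⟨
      (1# - 1#) + (m ×ₙ 1# - n ×ₙ 1#)    ≈⟨ interchange _ _ _ _ ⟩
      (1# + m ×ₙ 1#) + (- 1# - n ×ₙ 1#)  ≈⟨ +-congˡ (⁻¹-∙-comm _ _) ⟩
      (1# + m ×ₙ 1#) - (1# + n ×ₙ 1#)    ≈⟨ +-cong (×-homo-+ 1# 1 m) (-‿cong (×-homo-+ 1# 1 n)) ⟨
      suc m ×ₙ 1# - suc n ×ₙ 1#          ∎

    +-homo : ∀ i j → ⟦ i ℤ.+ j ⟧ᶻ ≈ ⟦ i ⟧ᶻ + ⟦ j ⟧ᶻ
    +-homo (ℤ.+ m) (ℤ.+ n) = ×-homo-+ 1# m n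
    +-homo (ℤ.+ m) -[1+ n ] = ⊖-homo m (suc n)
    +-homo -[1+ m ] (ℤ.+ n) = ≈-trans (⊖-homo n (suc m)) (+-comm _ _)
    +-homo -[1+ m ] -[1+ n ] = begin
      - (suc (suc (m ℕ.+ n)) ×ₙ 1#)    ≡⟨ cong (λ k → - (k ×ₙ 1#)) (ℕ.+-suc (suc m) n) ⟨
      - ((suc m ℕ.+ suc n) ×ₙ 1#)      ≈⟨ -‿cong (×-homo-+ 1# (suc m) (suc n)) ⟩
      - (suc m ×ₙ 1# + suc n ×ₙ 1#)    ≈⟨ ⁻¹-∙-comm _ _ ⟨
      - (suc m ×ₙ 1#) - (suc n ×ₙ 1#)  ∎

    -‿homo : ∀ i → ⟦ ℤ.- i ⟧ᶻ ≈ - ⟦ i ⟧ᶻ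
    -‿homo (ℤ.+ zero) = ≈-sym ε⁻¹≈ε
    -‿homo (ℤ.+ suc n) = ≈-refl
    -‿homo -[1+ n ] = ≈-sym (⁻¹-involutive _)

    +◃-homo : ∀ n → ⟦ Sign.+ ◃ n ⟧ᶻ ≈ n ×ₙ 1#
    +◃-homo zero = ≈-refl
    +◃-homo (suc n) = ≈-refl

    -◃-homo : ∀ n → ⟦ Sign.- ◃ n ⟧ᶻ ≈ - (n ×ₙ 1#)
    -◃-homo zero = ≈-sym ε⁻¹≈ε
    -◃-homo (suc n) = ≈-refl

    -x*-y≈x*y : ∀ a b → - a * - b ≈ a * b
    -x*-y≈x*y a b = begin
      - a * - b      ≈⟨ -‿distribˡ-* a (- b) ⟨
      - (a * - b)    ≈⟨ -‿cong (-‿distribʳ-* a b) ⟨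
      - - (a * b)    ≈⟨ ⁻¹-involutive _ ⟩
      a * b          ∎

    *-homo : ∀ i j → ⟦ i ℤ.* j ⟧ᶻ ≈ ⟦ i ⟧ᶻ * ⟦ j ⟧ᶻ
    *-homo (ℤ.+ m) (ℤ.+ n) = ≈-trans (+◃-homo (m ℕ.* n)) (×1-homo-* m n)
    *-homo (ℤ.+ m) -[1+ n ] = begin
      ⟦ Sign.- ◃ (m ℕ.* suc n) ⟧ᶻ  ≈⟨ -◃-homo (m ℕ.* suc n) ⟩
      - ((m ℕ.* suc n) ×ₙ 1#)      ≈⟨ -‿cong (×1-homo-* m (suc n)) ⟩
      - (m ×ₙ 1# * suc n ×ₙ 1#)    ≈⟨ -‿distribʳ-* _ _ ⟩
      m ×ₙ 1# * - (suc n ×ₙ 1#)    ∎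
    *-homo -[1+ m ] (ℤ.+ n) = begin
      ⟦ Sign.- ◃ (suc m ℕ.* n) ⟧ᶻ  ≈⟨ -◃-homo (suc m ℕ.* n) ⟩
      - ((suc m ℕ.* n) ×ₙ 1#)      ≈⟨ -‿cong (×1-homo-* (suc m) n) ⟩
      - (suc m ×ₙ 1# * n ×ₙ 1#)    ≈⟨ -‿distribˡ-* _ _ ⟩
      - (suc m ×ₙ 1#) * n ×ₙ 1#    ∎
    *-homo -[1+ m ] -[1+ n ] = begin
      ⟦ Sign.+ ◃ (suc m ℕ.* suc n) ⟧ᶻ  ≈⟨ +◃-homo (suc m ℕ.* suc n) ⟩
      (suc m ℕ.* suc n) ×ₙ 1#          ≈⟨ ×1-homo-* (suc m) (suc n) ⟩
      suc m ×ₙ 1# * suc n ×ₙ 1#        ≈⟨ -x*-y≈x*y _ _ ⟨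
      - (suc m ×ₙ 1#) * - (suc n ×ₙ 1#) ∎

  homomorphism : ℤ.+-*-rawRing AlmostCommutativeRing.-Raw-AlmostCommutative⟶ AlmostCommutativeRing.fromCommutativeRing R
  homomorphism = record
    { ⟦_⟧ = ⟦_⟧ᶻ ; +-homo = +-homo ; *-homo = *-homo ; -‿homo = -‿homo ; 0-homo = ≈-refl ; 1-homo = ≈-refl }

  _≟ᶻ_ : WeaklyDecidable (AlmostCommutativeRing.Induced-equivalence homomorphism)
  i ≟ᶻ j with i ℤ.≟ j
  ... | yes i≡j = just (reflexive (cong ⟦_⟧ᶻ i≡j))
  ... | no _ = nothing

  open Algebra.Solver.Ring ℤ.+-*-rawRing (AlmostCommutativeRing.fromCommutativeRing R) homomorphism _≟ᶻ_ public

module FiniteType {a} {A : Set a} {n : ℕ} (enumeration : Fin n ↔ A) where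
  open Inverse enumeration using (to; from; strictlyInverseˡ; strictlyInverseʳ)

  rank : A → ℕ
  rank x = toℕ (from x)

  from-injective : ∀ {x y} → from x ≡ from y → x ≡ y
  from-injective {x} {y} eq = trans (sym (strictlyInverseˡ x)) (trans (cong to eq) (strictlyInverseˡ y))

  rank-injective : ∀ {x y} → rank x ≡ rank y → x ≡ y
  rank-injective eq = from-injective (Fin.toℕ-injective eq)

  infix 4 _≟_
  _≟_ : DecidableEquality A
  x ≟ y = Dec.map′ from-injective (cong from) (from x Fin.≟ from y)

  fin-injective⇒surjective : ∀ {m} (f : Fin m → Fin m) → (∀ {i j} → f i ≡ f j → i ≡ j) →
    ∀ k → ∃ λ i → f i ≡ k
  fin-injective⇒surjective {suc m} f f-inj k with Fin.any? (λ i → f i Fin.≟ k)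
  ... | yes hit = hit
  ... | no miss with Fin.pigeonhole (ℕ.n<1+n m) (λ i → punchOut (λ k≡fi → miss (i , sym k≡fi)))
  ...   | i , j , i<j , eq =
    ⊥-elim (Fin.<-irrefl (f-inj (Fin.punchOut-injective (λ e → miss (i , sym e)) (λ e → miss (j , sym e)) eq)) i<j)

  injective⇒surjective : (f : A → A) → (∀ {x y} → f x ≡ f y → x ≡ y) → ∀ y → ∃ λ x → f x ≡ y
  injective⇒surjective f f-inj y =
    let (i , eq) = fin-injective⇒surjective (λ i → from (f (to i))) transported-injective (from y)
    in to i , from-injective eq
    where
    transported-injective : ∀ {i j} → from (f (to i)) ≡ from (f (to j)) → i ≡ j
    transported-injective {i} {j} eq =
      trans (sym (strictlyInverseʳ i)) (trans (cong from (f-inj (from-injective eq))) (strictlyInverseʳ j))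

  -- Choosing φ on one representative of each σ-orbit and ψ ∘ φ on the other gives an
  -- injection, hence a bijection, so every element is hit by φ or by ψ ∘ φ.
  module TwoToOne (σ φ ψ : A → A)
    (σ-involutive : ∀ x → σ (σ x) ≡ x)
    (φ-fibres : ∀ {x y} → φ x ≡ φ y → y ≡ x ⊎ y ≡ σ x)
    (ψ-injective : ∀ {x y} → ψ x ≡ ψ y → x ≡ y)
    (disjoint : ∀ x y → σ y ≢ y → φ x ≢ ψ (φ y)) where

    Canonical : A → Set
    Canonical x = rank x ℕ.≤ rank (σ x)

    select : ∀ x → Dec (Canonical x) → A
    select x (yes _) = φ x
    select x (no _) = ψ (φ x)

    χ : A → A
    χ x = select x (rank x ℕ.≤? rank (σ x))

    non-canonical⇒moved : ∀ {x} → ¬ Canonical x → σ x ≢ x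
    non-canonical⇒moved ¬c σx≡x = ¬c (ℕ.≤-reflexive (cong rank (sym σx≡x)))

    both-canonical : ∀ {x y} → Canonical x → Canonical y → y ≡ x ⊎ y ≡ σ x → x ≡ y
    both-canonical _ _ (inj₁ y≡x) = sym y≡x
    both-canonical {x} {y} cx cy (inj₂ y≡σx) = rank-injective (ℕ.≤-antisym
      (ℕ.≤-trans cx (ℕ.≤-reflexive (cong rank (sym y≡σx))))
      (ℕ.≤-trans cy (ℕ.≤-reflexive (cong rank (trans (cong σ y≡σx) (σ-involutive x))))))

    both-non-canonical : ∀ {x y} → ¬ Canonical x → ¬ Canonical y → y ≡ x ⊎ y ≡ σ x → x ≡ y
    both-non-canonical _ _ (inj₁ y≡x) = sym y≡x
    both-non-canonical {x} {y} nx ny (inj₂ y≡σx) = ⊥-elim (ℕ.<-asym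
      (subst (ℕ._< rank y) (cong rank (trans (cong σ y≡σx) (σ-involutive x))) (ℕ.≰⇒> ny))
      (subst (ℕ._< rank x) (cong rank (sym y≡σx)) (ℕ.≰⇒> nx)))

    select-injective : ∀ {x y} (cx : Dec (Canonical x)) (cy : Dec (Canonical y)) →
      select x cx ≡ select y cy → x ≡ y
    select-injective (yes cx) (yes cy) eq = both-canonical cx cy (φ-fibres eq)
    select-injective (no nx) (no ny) eq = both-non-canonical nx ny (φ-fibres (ψ-injective eq))
    select-injective {x} {y} (yes _) (no ny) eq = ⊥-elim (disjoint x y (non-canonical⇒moved ny) eq)
    select-injective {x} {y} (no nx) (yes _) eq = ⊥-elim (disjoint y x (non-canonical⇒moved nx) (sym eq))

    select-hit : ∀ {x z} (cx : Dec (Canonical x)) → select x cx ≡ z →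
      (∃ λ w → φ w ≡ z) ⊎ (∃ λ w → ψ (φ w) ≡ z)
    select-hit {x} (yes _) eq = inj₁ (x , eq)
    select-hit {x} (no _) eq = inj₂ (x , eq)

    χ-injective : ∀ {x y} → χ x ≡ χ y → x ≡ y
    χ-injective {x} {y} = select-injective (rank x ℕ.≤? rank (σ x)) (rank y ℕ.≤? rank (σ y))

    covers : ∀ z → (∃ λ w → φ w ≡ z) ⊎ (∃ λ w → ψ (φ w) ≡ z)
    covers z with injective⇒surjective χ χ-injective z
    ... | x , eq = select-hit (rank x ℕ.≤? rank (σ x)) eq

module FieldProperties {q : ℕ} (F : FiniteField q) where
  open FiniteField F public
  open Plane F using (two)

  commutativeRing : CommutativeRing 0ℓ 0ℓ
  commutativeRing = record { isCommutativeRing = isCommutativeRing }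

  open CommutativeRing commutativeRing public
    using (+-identityˡ; +-identityʳ; -‿inverseʳ; *-comm; *-identityˡ; *-identityʳ; zeroˡ; zeroʳ)
  open IntegerCoefficients commutativeRing public using (solve; _:=_; _:+_; _:*_; :-_; _:-_; con; Polynomial)

  :0 :1 :2 : ∀ {n} → Polynomial n
  :0 = con (ℤ.+ 0)
  :1 = con (ℤ.+ 1)
  :2 = con (ℤ.+ 2)

  open FiniteType enumeration public using (_≟_; injective⇒surjective; module TwoToOne)

  1≢0 : 1# ≢ 0#
  1≢0 1≡0 = 0≢1 (sym 1≡0)

  _⁻¹ : ∀ {x} → x ≢ 0# → Carrier
  x≢0 ⁻¹ = proj₁ (inverse _ x≢0)

  *-inverseʳ : ∀ {x} (x≢0 : x ≢ 0#) → x * x≢0 ⁻¹ ≡ 1#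
  *-inverseʳ x≢0 = proj₂ (inverse _ x≢0)

  *≡0-cancelˡ : ∀ {a b} → a ≢ 0# → a * b ≡ 0# → b ≡ 0#
  *≡0-cancelˡ {a} {b} a≢0 ab≡0 = begin
    b                        ≡⟨ sym (*-identityˡ b) ⟩
    1# * b                   ≡⟨ cong (_* b) (*-inverseʳ a≢0) ⟨
    a * a≢0 ⁻¹ * b           ≡⟨ solve 3 (λ a a' b → a :* a' :* b := a' :* (a :* b)) refl a (a≢0 ⁻¹) b ⟩
    a≢0 ⁻¹ * (a * b)         ≡⟨ cong (a≢0 ⁻¹ *_) ab≡0 ⟩
    a≢0 ⁻¹ * 0#              ≡⟨ zeroʳ _ ⟩
    0#                       ∎
    where open ≡-Reasoning

  *-≢0 : ∀ {a b} → a ≢ 0# → b ≢ 0# → a * b ≢ 0#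
  *-≢0 a≢0 b≢0 ab≡0 = b≢0 (*≡0-cancelˡ a≢0 ab≡0)

  -‿involutive : ∀ x → - - x ≡ x
  -‿involutive = solve 1 (λ x → :- (:- x) := x) refl

  -0≡0 : - 0# ≡ 0#
  -0≡0 = solve 0 (:- :0 := :0) refl

  -‿≢0 : ∀ {a} → a ≢ 0# → - a ≢ 0#
  -‿≢0 {a} a≢0 -a≡0 = a≢0 (trans (sym (-‿involutive a)) (trans (cong -_ -a≡0) -0≡0))

  ⁻¹-≢0 : ∀ {x} (x≢0 : x ≢ 0#) → x≢0 ⁻¹ ≢ 0#
  ⁻¹-≢0 {x} x≢0 x⁻¹≡0 = 1≢0 (trans (sym (*-inverseʳ x≢0)) (trans (cong (x *_) x⁻¹≡0) (zeroʳ x)))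

  *≡0⇒either≡0 : ∀ {a b} → a * b ≡ 0# → a ≡ 0# ⊎ b ≡ 0#
  *≡0⇒either≡0 {a} ab≡0 with a ≟ 0#
  ... | yes a≡0 = inj₁ a≡0
  ... | no a≢0 = inj₂ (*≡0-cancelˡ a≢0 ab≡0)

  x-y≡0⇒x≡y : ∀ {x y} → x + - y ≡ 0# → x ≡ y
  x-y≡0⇒x≡y {x} {y} x-y≡0 = begin
    x                  ≡⟨ solve 2 (λ x y → x := (x :- y) :+ y) refl x y ⟩
    (x + - y) + y      ≡⟨ cong (_+ y) x-y≡0 ⟩
    0# + y             ≡⟨ +-identityˡ y ⟩
    y                  ∎
    where open ≡-Reasoning

  nontrivial-solution : ∀ a b → Σ Carrier λ x → Σ Carrier λ y → (x ≢ 0# ⊎ y ≢ 0#) × x * a + y * b ≡ 0#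
  nontrivial-solution a b with a ≟ 0#
  ... | yes a≡0 = 1# , 0# , inj₁ 1≢0 , trans (solve 2 (λ a b → :1 :* a :+ :0 :* b := a) refl a b) a≡0
  ... | no a≢0 = b , - a , inj₂ (-‿≢0 a≢0) , solve 2 (λ a b → b :* a :+ :- a :* b := :0) refl a b

  *-cancelˡ : ∀ {a x y} → a ≢ 0# → a * x ≡ a * y → x ≡ y
  *-cancelˡ {a} {x} {y} a≢0 ax≡ay = x-y≡0⇒x≡y (*≡0-cancelˡ a≢0 (begin
    a * (x + - y)      ≡⟨ solve 3 (λ a x y → a :* (x :- y) := a :* x :- a :* y) refl a x y ⟩
    a * x + - (a * y)  ≡⟨ cong (λ t → t + - (a * y)) ax≡ay ⟩
    a * y + - (a * y)  ≡⟨ -‿inverseʳ _ ⟩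
    0#                 ∎))
    where open ≡-Reasoning

  Square : Carrier → Set
  Square d = ∃ λ w → w * w ≡ d

  nonsquare≢0 : ∀ {d} → ¬ Square d → d ≢ 0#
  nonsquare≢0 ¬□ d≡0 = ¬□ (0# , trans (zeroʳ 0#) (sym d≡0))

  square-fibres : ∀ {x y} → x * x ≡ y * y → y ≡ x ⊎ y ≡ - x
  square-fibres {x} {y} x²≡y² with *≡0⇒either≡0 {x + - y} {x + y} (begin
    (x + - y) * (x + y)   ≡⟨ solve 2 (λ x y → (x :- y) :* (x :+ y) := x :* x :- y :* y) refl x y ⟩
    x * x + - (y * y)     ≡⟨ cong (λ t → t + - (y * y)) x²≡y² ⟩
    y * y + - (y * y)     ≡⟨ -‿inverseʳ _ ⟩
    0#                    ∎)
    where open ≡-Reasoning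
  ... | inj₁ x-y≡0 = inj₁ (sym (x-y≡0⇒x≡y x-y≡0))
  ... | inj₂ x+y≡0 = inj₂ (x-y≡0⇒x≡y (trans (solve 2 (λ x y → y :- (:- x) := x :+ y) refl x y) x+y≡0))

  square≢nonsquare*square : ∀ {d x y} → ¬ Square d → y ≢ 0# → x * x ≢ d * (y * y)
  square≢nonsquare*square {d} {x} {y} ¬□d y≢0 x²≡dy² = ¬□d (x * y⁻¹ , (begin
    x * y⁻¹ * (x * y⁻¹)          ≡⟨ solve 2 (λ x y' → x :* y' :* (x :* y') := x :* x :* (y' :* y')) refl x y⁻¹ ⟩
    x * x * (y⁻¹ * y⁻¹)          ≡⟨ cong (_* (y⁻¹ * y⁻¹)) x²≡dy² ⟩
    d * (y * y) * (y⁻¹ * y⁻¹)    ≡⟨ solve 3 (λ d y y' → d :* (y :* y) :* (y' :* y') := d :* ((y :* y') :* (y :* y')))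
                                      refl d y y⁻¹ ⟩
    d * ((y * y⁻¹) * (y * y⁻¹))  ≡⟨ cong (λ t → d * (t * t)) (*-inverseʳ y≢0) ⟩
    d * (1# * 1#)                ≡⟨ solve 1 (λ d → d :* (:1 :* :1) := d) refl d ⟩
    d                            ∎))
    where
    open ≡-Reasoning
    y⁻¹ : Carrier
    y⁻¹ = y≢0 ⁻¹

  nonsquare*nonsquare : ∀ {d₁ d₂} → ¬ Square d₁ → ¬ Square d₂ → Square (d₁ * d₂)
  nonsquare*nonsquare {d₁} {d₂} ¬□d₁ ¬□d₂ = conclude (TwoToOne.covers -_ (λ x → x * x) (d₁ *_)
    -‿involutive square-fibres (*-cancelˡ (nonsquare≢0 ¬□d₁)) disjoint d₂)
    where
    moved⇒≢0 : ∀ {y} → - y ≢ y → y ≢ 0#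
    moved⇒≢0 {y} -y≢y y≡0 = -y≢y (trans (cong -_ y≡0) (trans -0≡0 (sym y≡0)))
    disjoint : ∀ x y → - y ≢ y → x * x ≢ d₁ * (y * y)
    disjoint x y -y≢y = square≢nonsquare*square ¬□d₁ (moved⇒≢0 -y≢y)
    conclude : Square d₂ ⊎ (∃ λ w → d₁ * (w * w) ≡ d₂) → Square (d₁ * d₂)
    conclude (inj₁ □d₂) = ⊥-elim (¬□d₂ □d₂)
    conclude (inj₂ (w , d₁w²≡d₂)) =
      d₁ * w , trans (solve 2 (λ d w → d :* w :* (d :* w) := d :* (d :* (w :* w))) refl d₁ w) (cong (d₁ *_) d₁w²≡d₂)

  ArtinSchreier : Carrier → Set
  ArtinSchreier c = ∃ λ z → z * z + z ≡ c

  module Characteristic2 (two≡0 : two ≡ 0#) where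
    two*≡0 : ∀ a → two * a ≡ 0#
    two*≡0 a = trans (cong (_* a) two≡0) (zeroˡ a)

    +-self-inverse : ∀ a b → a + b + b ≡ a
    +-self-inverse a b = trans (solve 2 (λ a b → a :+ b :+ b := a :+ :2 :* b) refl a b)
      (trans (cong (a +_) (two*≡0 b)) (+-identityʳ a))

    -x≡x : ∀ x → - x ≡ x
    -x≡x x = trans (sym (+-self-inverse (- x) x)) (solve 1 (λ x → :- x :+ x :+ x := x) refl x)

    square-injective : ∀ {x y} → x * x ≡ y * y → x ≡ y
    square-injective {x} {y} x²≡y² with square-fibres x²≡y²
    ... | inj₁ y≡x = sym y≡x
    ... | inj₂ y≡-x = sym (trans y≡-x (-x≡x x))

    every-square : ∀ d → Square d
    every-square = injective⇒surjective (λ x → x * x) square-injective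

    artinSchreier-fibres : ∀ {x y} → x * x + x ≡ y * y + y → y ≡ x ⊎ y ≡ - (x + 1#)
    artinSchreier-fibres {x} {y} eq with *≡0⇒either≡0 {x + - y} {x + y + 1#} (begin
      (x + - y) * (x + y + 1#)       ≡⟨ solve 2 (λ x y → (x :- y) :* (x :+ y :+ :1) := (x :* x :+ x) :- (y :* y :+ y))
                                          refl x y ⟩
      (x * x + x) + - (y * y + y)    ≡⟨ cong (λ t → t + - (y * y + y)) eq ⟩
      (y * y + y) + - (y * y + y)    ≡⟨ -‿inverseʳ _ ⟩
      0#                             ∎)
      where open ≡-Reasoning
    ... | inj₁ x-y≡0 = inj₁ (sym (x-y≡0⇒x≡y x-y≡0))
    ... | inj₂ x+y+1≡0 =
      inj₂ (x-y≡0⇒x≡y (trans (solve 2 (λ x y → y :- (:- (x :+ :1)) := x :+ y :+ :1) refl x y) x+y+1≡0))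

    ¬artinSchreier+artinSchreier : ∀ {c x y} → ¬ ArtinSchreier c → x * x + x ≢ c + (y * y + y)
    ¬artinSchreier+artinSchreier {c} {x} {y} ¬c eq = ¬c (x + y , (begin
      (x + y) * (x + y) + (x + y)              ≡⟨ solve 2 (λ x y → (x :+ y) :* (x :+ y) :+ (x :+ y)
                                                    := (x :* x :+ x) :+ (y :* y :+ y) :+ :2 :* (x :* y)) refl x y ⟩
      (x * x + x) + (y * y + y) + two * (x * y) ≡⟨ cong₂ (λ s t → s + (y * y + y) + t) eq (two*≡0 _) ⟩
      c + (y * y + y) + (y * y + y) + 0#       ≡⟨ trans (+-identityʳ _) (+-self-inverse c _) ⟩
      c                                        ∎))
      where open ≡-Reasoning

    ¬artinSchreier+¬artinSchreier : ∀ {c₁ c₂} → ¬ ArtinSchreier c₁ → ¬ ArtinSchreier c₂ → ArtinSchreier (c₁ + c₂)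
    ¬artinSchreier+¬artinSchreier {c₁} {c₂} ¬c₁ ¬c₂ =
      conclude (TwoToOne.covers (λ x → - (x + 1#)) (λ x → x * x + x) (c₁ +_)
        (solve 1 (λ x → :- (:- (x :+ :1) :+ :1) := x) refl) artinSchreier-fibres
        (λ {a} {b} eq → trans (sym (c+a-c≡a a)) (trans (cong (_+ - c₁) eq) (c+a-c≡a b)))
        (λ x y _ → ¬artinSchreier+artinSchreier ¬c₁) c₂)
      where
      c+a-c≡a : ∀ a → c₁ + a + - c₁ ≡ a
      c+a-c≡a = solve 2 (λ c a → c :+ a :- c := a) refl c₁
      conclude : ArtinSchreier c₂ ⊎ (∃ λ w → c₁ + (w * w + w) ≡ c₂) → ArtinSchreier (c₁ + c₂)
      conclude (inj₁ asc₂) = ⊥-elim (¬c₂ asc₂)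
      conclude (inj₂ (w , eq)) = w , (begin
        w * w + w                  ≡⟨ +-self-inverse (w * w + w) c₁ ⟨
        w * w + w + c₁ + c₁        ≡⟨ solve 3 (λ s c d → s :+ c :+ c := c :+ (c :+ s)) refl (w * w + w) c₁ c₁ ⟩
        c₁ + (c₁ + (w * w + w))    ≡⟨ cong (c₁ +_) eq ⟩
        c₁ + c₂                    ∎)
        where open ≡-Reasoning

module Projective {q : ℕ} (F : FiniteField q) where
  open FieldProperties F
  open Plane F

  record M2 : Set where
    no-eta-equality
    pattern
    constructor m2
    field a b c d : Carrier

  m2-cong : ∀ {a b c d a' b' c' d'} → a ≡ a' → b ≡ b' → c ≡ c' → d ≡ d' → m2 a b c d ≡ m2 a' b' c' d'
  m2-cong refl refl refl refl = refl

  v3-cong : ∀ {x y z x' y' z'} → x ≡ x' → y ≡ y' → z ≡ z' → v3 x y z ≡ v3 x' y' z'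
  v3-cong refl refl refl = refl

  det : M2 → Carrier
  det (m2 a b c d) = det2 a b c d

  tr : M2 → Carrier
  tr (m2 a b c d) = a + d

  infixl 7 _∙_
  _∙_ : M2 → M2 → M2
  m2 a b c d ∙ m2 e f g h = m2 (a * e + b * g) (a * f + b * h) (c * e + d * g) (c * f + d * h)

  scalar : Carrier → M2
  scalar s = m2 s 0# 0# s

  adj : M2 → M2
  adj (m2 a b c d) = m2 d (- b) (- c) a

  det-∙ : ∀ X Y → det (X ∙ Y) ≡ det X * det Y
  det-∙ (m2 a b c d) (m2 e f g h) = solve 8 (λ a b c d e f g h →
    (a :* e :+ b :* g) :* (c :* f :+ d :* h) :- (a :* f :+ b :* h) :* (c :* e :+ d :* g)
      := (a :* d :- b :* c) :* (e :* h :- f :* g)) refl a b c d e f g h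

  det-adj : ∀ B → det (adj B) ≡ det B
  det-adj (m2 a b c d) = solve 4 (λ a b c d → d :* a :- (:- b) :* (:- c) := a :* d :- b :* c) refl a b c d

  ∙-adj : ∀ B → B ∙ adj B ≡ scalar (det B)
  ∙-adj (m2 a b c d) = m2-cong
    (solve 4 (λ a b c d → a :* d :+ b :* (:- c) := a :* d :- b :* c) refl a b c d)
    (solve 2 (λ a b → a :* (:- b) :+ b :* a := :0) refl a b)
    (solve 2 (λ c d → c :* d :+ d :* (:- c) := :0) refl c d)
    (solve 4 (λ a b c d → c :* (:- b) :+ d :* a := a :* d :- b :* c) refl a b c d)

  adj-∙ : ∀ B → adj B ∙ B ≡ scalar (det B)
  adj-∙ (m2 a b c d) = m2-cong
    (solve 4 (λ a b c d → d :* a :+ (:- b) :* c := a :* d :- b :* c) refl a b c d)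
    (solve 2 (λ b d → d :* b :+ (:- b) :* d := :0) refl b d)
    (solve 2 (λ a c → (:- c) :* a :+ a :* c := :0) refl a c)
    (solve 4 (λ a b c d → (:- c) :* b :+ a :* d := a :* d :- b :* c) refl a b c d)

  trace-zero-square : ∀ M → tr M ≡ 0# → M ∙ M ≡ scalar (- det M)
  trace-zero-square (m2 a b c d) a+d≡0 = m2-cong
    (trans (solve 4 (λ a b c d → a :* a :+ b :* c := :- (a :* d :- b :* c) :+ a :* (a :+ d)) refl a b c d) (absorb _ a))
    (trans (solve 3 (λ a b d → a :* b :+ b :* d := :0 :+ b :* (a :+ d)) refl a b d) (absorb _ b))
    (trans (solve 3 (λ a c d → c :* a :+ d :* c := :0 :+ c :* (a :+ d)) refl a c d) (absorb _ c))
    (trans (solve 4 (λ a b c d → c :* b :+ d :* d := :- (a :* d :- b :* c) :+ d :* (a :+ d)) refl a b c d) (absorb _ d))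
    where
    absorb : ∀ k x → k + x * (a + d) ≡ k
    absorb k x = trans (cong (λ t → k + x * t) a+d≡0) (trans (cong (k +_) (zeroʳ x)) (+-identityʳ k))

  conicPoint : Carrier → Carrier → V3
  conicPoint s t = v3 (s * t) (s * s) (t * t)

  form : V3 → Carrier → Carrier → Carrier
  form w s t = dot w (conicPoint s t)

  abstract
    -- w times the matrix of ρ a b c d, whose columns are (ad + bc, 2ab, 2cd),
    -- conicPoint a c and conicPoint b d.
    infixl 7 _·_
    _·_ : V3 → M2 → V3
    w · m2 a b c d = v3 (dot w (v3 (a * d + b * c) (two * a * b) (two * c * d))) (form w a c) (form w b d)

    ·-unfold : ∀ w a b c d →
      w · m2 a b c d ≡ v3 (dot w (v3 (a * d + b * c) (two * a * b) (two * c * d))) (form w a c) (form w b d)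
    ·-unfold w a b c d = refl

    dot-ρ : ∀ a b c d v x → dot v (ρ a b c d x) ≡ dot (v · m2 a b c d) x
    dot-ρ a b c d (v3 v₁ v₂ v₃) (v3 x y z) = solve 10 (λ a b c d v₁ v₂ v₃ x y z →
      v₁ :* ((a :* d :+ b :* c) :* x :+ a :* c :* y :+ b :* d :* z)
        :+ v₂ :* (:2 :* a :* b :* x :+ a :* a :* y :+ b :* b :* z)
        :+ v₃ :* (:2 :* c :* d :* x :+ c :* c :* y :+ d :* d :* z)
      := (v₁ :* (a :* d :+ b :* c) :+ v₂ :* (:2 :* a :* b) :+ v₃ :* (:2 :* c :* d)) :* x
        :+ (v₁ :* (a :* c) :+ v₂ :* (a :* a) :+ v₃ :* (c :* c)) :* y
        :+ (v₁ :* (b :* d) :+ v₂ :* (b :* b) :+ v₃ :* (d :* d)) :* z) refl a b c d v₁ v₂ v₃ x y z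

    form-· : ∀ w a b c d s t → form (w · m2 a b c d) s t ≡ form w (a * s + b * t) (c * s + d * t)
    form-· (v3 w₁ w₂ w₃) a b c d s t = solve 9 (λ w₁ w₂ w₃ a b c d s t →
      (w₁ :* (a :* d :+ b :* c) :+ w₂ :* (:2 :* a :* b) :+ w₃ :* (:2 :* c :* d)) :* (s :* t)
        :+ (w₁ :* (a :* c) :+ w₂ :* (a :* a) :+ w₃ :* (c :* c)) :* (s :* s)
        :+ (w₁ :* (b :* d) :+ w₂ :* (b :* b) :+ w₃ :* (d :* d)) :* (t :* t)
      := w₁ :* ((a :* s :+ b :* t) :* (c :* s :+ d :* t))
        :+ w₂ :* ((a :* s :+ b :* t) :* (a :* s :+ b :* t))
        :+ w₃ :* ((c :* s :+ d :* t) :* (c :* s :+ d :* t))) refl w₁ w₂ w₃ a b c d s t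

  -- A form is determined by its values at (1,0), (0,1) and (1,1).
  form-injective : ∀ {w w'} → (∀ s t → form w s t ≡ form w' s t) → w ≡ w'
  form-injective {v3 w₁ w₂ w₃} {v3 w₁' w₂' w₃'} eq = v3-cong
    (trans (coefficient₁ w₁ w₂ w₃)
      (trans (cong₂ (λ x y → x + - y) (cong₂ (λ x y → x + - y) (eq 1# 1#) (eq 1# 0#)) (eq 0# 1#))
        (sym (coefficient₁ w₁' w₂' w₃'))))
    (trans (coefficient₂ w₁ w₂ w₃) (trans (eq 1# 0#) (sym (coefficient₂ w₁' w₂' w₃'))))
    (trans (coefficient₃ w₁ w₂ w₃) (trans (eq 0# 1#) (sym (coefficient₃ w₁' w₂' w₃'))))
    where
    formᴾ : ∀ {n} → (x y z s t : Polynomial n) → Polynomial n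
    formᴾ x y z s t = x :* (s :* t) :+ y :* (s :* s) :+ z :* (t :* t)
    coefficient₁ : ∀ x y z → x ≡ form (v3 x y z) 1# 1# + - form (v3 x y z) 1# 0# + - form (v3 x y z) 0# 1#
    coefficient₁ = solve 3 (λ x y z → x := formᴾ x y z :1 :1 :- formᴾ x y z :1 :0 :- formᴾ x y z :0 :1) refl
    coefficient₂ : ∀ x y z → y ≡ form (v3 x y z) 1# 0#
    coefficient₂ = solve 3 (λ x y z → y := formᴾ x y z :1 :0) refl
    coefficient₃ : ∀ x y z → z ≡ form (v3 x y z) 0# 1#
    coefficient₃ = solve 3 (λ x y z → z := formᴾ x y z :0 :1) refl

  form-scale : ∀ k w s t → form (scale k w) s t ≡ k * form w s t
  form-scale k (v3 w₁ w₂ w₃) s t = solve 6 (λ k w₁ w₂ w₃ s t →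
    k :* w₁ :* (s :* t) :+ k :* w₂ :* (s :* s) :+ k :* w₃ :* (t :* t)
      := k :* (w₁ :* (s :* t) :+ w₂ :* (s :* s) :+ w₃ :* (t :* t))) refl k w₁ w₂ w₃ s t

  form-homogeneous : ∀ w k s t → form w (k * s) (k * t) ≡ k * k * form w s t
  form-homogeneous (v3 w₁ w₂ w₃) k s t = solve 6 (λ w₁ w₂ w₃ k s t →
    w₁ :* (k :* s :* (k :* t)) :+ w₂ :* (k :* s :* (k :* s)) :+ w₃ :* (k :* t :* (k :* t))
      := k :* k :* (w₁ :* (s :* t) :+ w₂ :* (s :* s) :+ w₃ :* (t :* t))) refl w₁ w₂ w₃ k s t

  ·-∙ : ∀ w X Y → w · (X ∙ Y) ≡ (w · X) · Y
  ·-∙ w X@(m2 a b c d) Y@(m2 e f g h) = form-injective λ s t → begin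
    form (w · (X ∙ Y)) s t
      ≡⟨ form-· w _ _ _ _ s t ⟩
    form w ((a * e + b * g) * s + (a * f + b * h) * t) ((c * e + d * g) * s + (c * f + d * h) * t)
      ≡⟨ cong₂ (form w) (regroup a b s t) (regroup c d s t) ⟩
    form w (a * (e * s + f * t) + b * (g * s + h * t)) (c * (e * s + f * t) + d * (g * s + h * t))
      ≡⟨ form-· w a b c d _ _ ⟨
    form (w · X) (e * s + f * t) (g * s + h * t)
      ≡⟨ form-· (w · X) e f g h s t ⟨
    form ((w · X) · Y) s t ∎
    where
    open ≡-Reasoning
    regroup : ∀ x y s t → (x * e + y * g) * s + (x * f + y * h) * t ≡ x * (e * s + f * t) + y * (g * s + h * t)
    regroup x y s t = solve 8 (λ x y e f g h s t →
      (x :* e :+ y :* g) :* s :+ (x :* f :+ y :* h) :* t := x :* (e :* s :+ f :* t) :+ y :* (g :* s :+ h :* t))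
      refl x y e f g h s t

  ·-scale : ∀ k w X → scale k w · X ≡ scale k (w · X)
  ·-scale k w X@(m2 a b c d) = form-injective λ s t → begin
    form (scale k w · X) s t                   ≡⟨ form-· (scale k w) a b c d s t ⟩
    form (scale k w) (a * s + b * t) (c * s + d * t) ≡⟨ form-scale k w _ _ ⟩
    k * form w (a * s + b * t) (c * s + d * t) ≡⟨ cong (k *_) (form-· w a b c d s t) ⟨
    k * form (w · X) s t                       ≡⟨ form-scale k (w · X) s t ⟨
    form (scale k (w · X)) s t                 ∎
    where open ≡-Reasoning

  ·-scalar : ∀ w s → w · scalar s ≡ scale (s * s) w
  ·-scalar w s = form-injective λ x y → begin
    form (w · scalar s) x y                  ≡⟨ form-· w s 0# 0# s x y ⟩
    form w (s * x + 0# * y) (0# * x + s * y) ≡⟨ cong₂ (form w) (solve 3 (λ s x y → s :* x :+ :0 :* y := s :* x) refl s x y)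
                                                                (solve 3 (λ s x y → :0 :* x :+ s :* y := s :* y) refl s x y) ⟩
    form w (s * x) (s * y)                   ≡⟨ form-homogeneous w s x y ⟩
    s * s * form w x y                       ≡⟨ form-scale (s * s) w x y ⟨
    form (scale (s * s) w) x y               ∎
    where open ≡-Reasoning

  scale-scale : ∀ k l w → scale k (scale l w) ≡ scale (k * l) w
  scale-scale k l (v3 x y z) = v3-cong (assoc x) (assoc y) (assoc z)
    where
    assoc : ∀ x → k * (l * x) ≡ k * l * x
    assoc = solve 3 (λ k l x → k :* (l :* x) := k :* l :* x) refl k l

  scale-one : ∀ w → scale 1# w ≡ w
  scale-one (v3 x y z) = v3-cong (*-identityˡ x) (*-identityˡ y) (*-identityˡ z)

  dot-scale : ∀ k w x → dot (scale k w) x ≡ k * dot w x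
  dot-scale k (v3 w₁ w₂ w₃) (v3 x y z) = solve 7 (λ k w₁ w₂ w₃ x y z →
    k :* w₁ :* x :+ k :* w₂ :* y :+ k :* w₃ :* z := k :* (w₁ :* x :+ w₂ :* y :+ w₃ :* z)) refl k w₁ w₂ w₃ x y z

  infix 4 _∼_
  _∼_ : V3 → V3 → Set
  _∼_ = Proportional

  ∼-refl : ∀ {u} → u ∼ u
  ∼-refl {u} = 1# , 1≢0 , sym (scale-one u)

  ∼-sym : ∀ {u v} → u ∼ v → v ∼ u
  ∼-sym {u} {v} (k , k≢0 , v≡ku) = k≢0 ⁻¹ , ⁻¹-≢0 k≢0 , (begin
    u                           ≡⟨ scale-one u ⟨
    scale 1# u                  ≡⟨ cong (λ l → scale l u) (trans (*-comm _ k) (*-inverseʳ k≢0)) ⟨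
    scale (k≢0 ⁻¹ * k) u        ≡⟨ scale-scale _ k u ⟨
    scale (k≢0 ⁻¹) (scale k u)  ≡⟨ cong (scale (k≢0 ⁻¹)) v≡ku ⟨
    scale (k≢0 ⁻¹) v            ∎)
    where open ≡-Reasoning

  ∼-trans : ∀ {u v w} → u ∼ v → v ∼ w → u ∼ w
  ∼-trans {u} (k , k≢0 , v≡ku) (l , l≢0 , w≡lv) =
    l * k , *-≢0 l≢0 k≢0 , trans w≡lv (trans (cong (scale l) v≡ku) (scale-scale l k u))

  ∼-setoid : Setoid _ _
  ∼-setoid = record
    { Carrier = V3
    ; _≈_ = _∼_
    ; isEquivalence = record { refl = ∼-refl ; sym = ∼-sym ; trans = ∼-trans }
    }

  scale-∼ : ∀ {k} w → k ≢ 0# → w ∼ scale k w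
  scale-∼ w k≢0 = _ , k≢0 , refl

  ∼-from-scale : ∀ {w u k} → k ≢ 0# → w ≡ scale k u → w ∼ u
  ∼-from-scale {u = u} k≢0 w≡ku = ∼-sym (subst (u ∼_) (sym w≡ku) (scale-∼ u k≢0))

  ·-∼ : ∀ {u v} X → u ∼ v → u · X ∼ v · X
  ·-∼ {u} X (k , k≢0 , v≡ku) = k , k≢0 , trans (cong (_· X) v≡ku) (·-scale k u X)

  ∼⇒mapsLine : ∀ {u v a b c d} → v · m2 a b c d ∼ u → MapsLine (ρ a b c d) u v
  ∼⇒mapsLine {u} {v} {a} {b} {c} {d} (k , k≢0 , u≡k[vA]) x _ = to , from
    where
    transported : dot u x ≡ k * dot v (ρ a b c d x)
    transported = trans (cong (λ w → dot w x) u≡k[vA])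
      (trans (dot-scale k _ x) (cong (k *_) (sym (dot-ρ a b c d v x))))
    to : Incident u x → Incident v (ρ a b c d x)
    to ux≡0 = *≡0-cancelˡ k≢0 (trans (sym transported) ux≡0)
    from : Incident v (ρ a b c d x) → Incident u x
    from vρx≡0 = trans transported (trans (cong (k *_) vρx≡0) (zeroʳ k))

  record Invertible (B : M2) : Set where
    constructor invertible
    field det≢0 : det B ≢ 0#
  open Invertible public

  ∙-invertible : ∀ {X Y} → Invertible X → Invertible Y → Invertible (X ∙ Y)
  ∙-invertible {X} {Y} (invertible dX) (invertible dY) = invertible λ eq → *-≢0 dX dY (trans (sym (det-∙ X Y)) eq)

  adj-invertible : ∀ {B} → Invertible B → Invertible (adj B)
  adj-invertible {B} (invertible dB) = invertible λ eq → dB (trans (sym (det-adj B)) eq)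

  ·-scalar-∼ : ∀ {s} w → s ≢ 0# → w ∼ w · scalar s
  ·-scalar-∼ w s≢0 = subst (w ∼_) (sym (·-scalar w _)) (scale-∼ w (*-≢0 s≢0 s≢0))

  ·-∙-adj : ∀ {B} w → Invertible B → w ∼ (w · B) · adj B
  ·-∙-adj {B} w (invertible dB) = subst (w ∼_) (trans (cong (w ·_) (sym (∙-adj B))) (·-∙ w B (adj B))) (·-scalar-∼ w dB)

  ·-adj-∙ : ∀ {B} w → Invertible B → w ∼ (w · adj B) · B
  ·-adj-∙ {B} w (invertible dB) = subst (w ∼_) (trans (cong (w ·_) (sym (adj-∙ B))) (·-∙ w (adj B) B)) (·-scalar-∼ w dB)

  upperTriangular-invertible : ∀ {a b d} → a ≢ 0# → d ≢ 0# → Invertible (m2 a b 0# d)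
  upperTriangular-invertible {a} {b} {d} a≢0 d≢0 = invertible (subst (_≢ 0#)
    (solve 3 (λ a b d → a :* d := a :* d :- b :* :0) refl a b d) (*-≢0 a≢0 d≢0))

  InOrbit : V3 → V3 → Set
  InOrbit N u = Σ M2 λ B → Invertible B × N · B ∼ u

  Stabilises : M2 → V3 → Set
  Stabilises S N = Invertible S × N · S ∼ N

  CosetsMeetTraceZero : V3 → Set
  CosetsMeetTraceZero N = ∀ T → Invertible T → Σ M2 λ S → Stabilises S N × tr (T ∙ S) ≡ 0#

  SharedOrbit : V3 → V3 → Set
  SharedOrbit u v = Σ V3 λ N → CosetsMeetTraceZero N × InOrbit N u × InOrbit N v

  Swaps : M2 → V3 → V3 → Set
  Swaps A u v = Invertible A × v · A ∼ u × u · A ∼ v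

  adj-stabilises : ∀ {S N} → Stabilises S N → Stabilises (adj S) N
  adj-stabilises {S} {N} (dS , NS∼N) = adj-invertible dS , (begin
    N · adj S        ≈⟨ ·-∼ (adj S) NS∼N ⟨
    (N · S) · adj S  ≈⟨ ·-∙-adj N dS ⟨
    N                ∎)
    where open SetoidReasoning ∼-setoid

  -- (T S)² is scalar, so N T S T S ∼ N, and S⁻¹ also fixes N.
  involution-returns : ∀ {N S T} → Stabilises S N → tr (T ∙ S) ≡ 0# → Invertible T → ((N · T) · S) · T ∼ N
  involution-returns {N} {S} {T} stab@(dS , _) trTS≡0 dT = begin
    w                        ≈⟨ ·-∙-adj w dS ⟩
    (w · S) · adj S          ≡⟨ cong (_· adj S) (sym TS-twice) ⟩
    (N · ((T ∙ S) ∙ (T ∙ S))) · adj S ≡⟨ cong (λ M → (N · M) · adj S) (trace-zero-square (T ∙ S) trTS≡0) ⟩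
    (N · scalar (- det (T ∙ S))) · adj S ≈⟨ ·-∼ (adj S) (·-scalar-∼ N (-‿≢0 (det≢0 (∙-invertible dT dS)))) ⟨
    N · adj S                ≈⟨ proj₂ (adj-stabilises stab) ⟩
    N                        ∎
    where
    open SetoidReasoning ∼-setoid
    w : V3
    w = ((N · T) · S) · T
    TS-twice : N · ((T ∙ S) ∙ (T ∙ S)) ≡ w · S
    TS-twice = trans (·-∙ N (T ∙ S) (T ∙ S)) (trans (cong (_· (T ∙ S)) (·-∙ N T S)) (·-∙ ((N · T) · S) T S))

  swap-within-orbit : ∀ {N u v} → CosetsMeetTraceZero N → InOrbit N u → InOrbit N v → Σ M2 λ A → Swaps A u v
  swap-within-orbit {N} {u} {v} cosets (Bu , dBu , NBu∼u) (Bv , dBv , NBv∼v) =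
    A , ∙-invertible (∙-invertible (adj-invertible dBv) dS) dBu , v·A∼u , u·A∼v
    where
    open SetoidReasoning ∼-setoid
    T : M2
    T = Bu ∙ adj Bv
    dT : Invertible T
    dT = ∙-invertible dBu (adj-invertible dBv)
    S : M2
    S = proj₁ (cosets T dT)
    stabilises : Stabilises S N
    stabilises = proj₁ (proj₂ (cosets T dT))
    dS : Invertible S
    dS = proj₁ stabilises
    trTS≡0 : tr (T ∙ S) ≡ 0#
    trTS≡0 = proj₂ (proj₂ (cosets T dT))
    A : M2
    A = (adj Bv ∙ S) ∙ Bu
    expand : ∀ w → w · A ≡ ((w · adj Bv) · S) · Bu
    expand w = trans (·-∙ w (adj Bv ∙ S) Bu) (cong (_· Bu) (·-∙ w (adj Bv) S))
    v·A∼u : v · A ∼ u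
    v·A∼u = begin
      v · A                              ≡⟨ expand v ⟩
      ((v · adj Bv) · S) · Bu            ≈⟨ ·-∼ Bu (·-∼ S (·-∼ (adj Bv) NBv∼v)) ⟨
      (((N · Bv) · adj Bv) · S) · Bu     ≈⟨ ·-∼ Bu (·-∼ S (·-∙-adj N dBv)) ⟨
      (N · S) · Bu                       ≈⟨ ·-∼ Bu (proj₂ stabilises) ⟩
      N · Bu                             ≈⟨ NBu∼u ⟩
      u                                  ∎
    u·A∼v : u · A ∼ v
    u·A∼v = begin
      u · A                              ≡⟨ expand u ⟩
      ((u · adj Bv) · S) · Bu            ≈⟨ ·-∼ Bu (·-∼ S (·-∼ (adj Bv) NBu∼u)) ⟨
      (((N · Bu) · adj Bv) · S) · Bu     ≡⟨ cong (λ w → (w · S) · Bu) (·-∙ N Bu (adj Bv)) ⟨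
      ((N · T) · S) · Bu                 ≈⟨ ·-adj-∙ (((N · T) · S) · Bu) dBv ⟩
      ((((N · T) · S) · Bu) · adj Bv) · Bv ≡⟨ cong (_· Bv) (·-∙ ((N · T) · S) Bu (adj Bv)) ⟨
      (((N · T) · S) · T) · Bv           ≈⟨ ·-∼ Bv (involution-returns {N} {S} {T} stabilises trTS≡0 dT) ⟩
      N · Bv                             ≈⟨ NBv∼v ⟩
      v                                  ∎

  swapping-collineation : ∀ {u v} → (Σ M2 λ A → Swaps A u v) →
    Σ Carrier λ a → Σ Carrier λ b → Σ Carrier λ c → Σ Carrier λ d →
      det2 a b c d ≢ 0# × MapsLine (ρ a b c d) u v × MapsLine (ρ a b c d) v u
  swapping-collineation {u} {v} (m2 a b c d , invertible dA , v·A∼u , u·A∼v) =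
    a , b , c , d , dA , ∼⇒mapsLine {u} {v} {a} {b} {c} {d} v·A∼u , ∼⇒mapsLine {v} {u} {a} {b} {c} {d} u·A∼v

  generouslyTransitive : ∀ {P} → (∀ {u v} → P u → P v → SharedOrbit u v) → GenerouslyTransitiveOnLines P
  generouslyTransitive common u v Pu Pv =
    let (N , cosets , orbit-u , orbit-v) = common Pu Pv
    in swapping-collineation (swap-within-orbit {N} {u} {v} cosets orbit-u orbit-v)

  inOrbit-trans : ∀ {N N' u} → InOrbit N N' → InOrbit N' u → InOrbit N u
  inOrbit-trans {N} {N'} {u} (W , dW , NW∼N') (B , dB , N'B∼u) = W ∙ B , ∙-invertible dW dB , (begin
    N · (W ∙ B)   ≡⟨ ·-∙ N W B ⟩
    (N · W) · B   ≈⟨ ·-∼ B NW∼N' ⟩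
    N' · B        ≈⟨ N'B∼u ⟩
    u             ∎)
    where open SetoidReasoning ∼-setoid

  inOrbit-of-preimage : ∀ {N u A} → Invertible A → N ∼ u · A → InOrbit N u
  inOrbit-of-preimage {N} {u} {A} dA N∼uA = adj A , adj-invertible dA , (begin
    N · adj A        ≈⟨ ·-∼ (adj A) N∼uA ⟩
    (u · A) · adj A  ≈⟨ ·-∙-adj u dA ⟨
    u                ∎)
    where open SetoidReasoning ∼-setoid

module BaseLines {q : ℕ} (F : FiniteField q) where
  open FieldProperties F
  open Plane F
  open Projective F

  secantBase : V3
  secantBase = v3 1# 0# 0#

  secantBase-· : ∀ a b c d → a * c ≡ 0# → b * d ≡ 0# → secantBase · m2 a b c d ≡ scale (a * d + b * c) secantBase
  secantBase-· a b c d ac≡0 bd≡0 = form-injective λ s t → begin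
    form (secantBase · m2 a b c d) s t
      ≡⟨ form-· secantBase a b c d s t ⟩
    form secantBase (a * s + b * t) (c * s + d * t)
      ≡⟨ solve 6 (λ a b c d s t →
           :1 :* ((a :* s :+ b :* t) :* (c :* s :+ d :* t)) :+ :0 :* ((a :* s :+ b :* t) :* (a :* s :+ b :* t))
             :+ :0 :* ((c :* s :+ d :* t) :* (c :* s :+ d :* t))
           := (a :* d :+ b :* c) :* (s :* t) :+ (a :* c) :* (s :* s) :+ (b :* d) :* (t :* t)) refl a b c d s t ⟩
    (a * d + b * c) * (s * t) + (a * c) * (s * s) + (b * d) * (t * t)
      ≡⟨ cong₂ (λ x y → (a * d + b * c) * (s * t) + x * (s * s) + y * (t * t)) ac≡0 bd≡0 ⟩
    (a * d + b * c) * (s * t) + 0# * (s * s) + 0# * (t * t)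
      ≡⟨ solve 3 (λ k s t → k :* (s :* t) :+ :0 :* (s :* s) :+ :0 :* (t :* t)
           := k :* (:1 :* (s :* t) :+ :0 :* (s :* s) :+ :0 :* (t :* t))) refl (a * d + b * c) s t ⟩
    (a * d + b * c) * form secantBase s t
      ≡⟨ form-scale (a * d + b * c) secantBase s t ⟨
    form (scale (a * d + b * c) secantBase) s t ∎
    where open ≡-Reasoning

  diagonal-coset : ∀ {p q r s} → p ≢ 0# → s ≢ 0# → Σ M2 λ S → Stabilises S secantBase × tr (m2 p q r s ∙ S) ≡ 0#
  diagonal-coset {p} {q} {r} {s} p≢0 s≢0 =
    m2 s 0# 0# (- p) ,
    (upperTriangular-invertible s≢0 (-‿≢0 p≢0) ,
     ∼-from-scale (subst (_≢ 0#) (solve 2 (λ s p → s :* :- p := s :* :- p :+ :0 :* :0) refl s p) s[-p]≢0)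
       (secantBase-· s 0# 0# (- p) (zeroʳ s) (zeroˡ (- p)))) ,
    solve 4 (λ p q r s → p :* s :+ q :* :0 :+ (r :* :0 :+ s :* :- p) := :0) refl p q r s
    where
    s[-p]≢0 : s * - p ≢ 0#
    s[-p]≢0 = *-≢0 s≢0 (-‿≢0 p≢0)

  antidiagonal-coset : ∀ {p q r s} → p * s ≡ 0# → det2 p q r s ≢ 0# →
    Σ M2 λ S → Stabilises S secantBase × tr (m2 p q r s ∙ S) ≡ 0#
  antidiagonal-coset {p} {q} {r} {s} ps≡0 detT≢0 =
    m2 0# q (- r) 0# ,
    (invertible (subst (_≢ 0#) (solve 2 (λ q r → q :* r := :0 :* :0 :- q :* :- r) refl q r) qr≢0) ,
     ∼-from-scale (subst (_≢ 0#) (solve 2 (λ q r → :- (q :* r) := :0 :* :0 :+ q :* :- r) refl q r) (-‿≢0 qr≢0))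
       (secantBase-· 0# q (- r) 0# (zeroˡ (- r)) (zeroʳ q))) ,
    solve 4 (λ p q r s → p :* :0 :+ q :* :- r :+ (r :* q :+ s :* :0) := :0) refl p q r s
    where
    qr≢0 : q * r ≢ 0#
    qr≢0 qr≡0 = detT≢0 (begin
      p * s + - (q * r)  ≡⟨ cong₂ (λ x y → x + - y) ps≡0 qr≡0 ⟩
      0# + - 0#          ≡⟨ solve 0 (:0 :- :0 := :0) refl ⟩
      0#                 ∎)
      where open ≡-Reasoning

  secantBase-cosets : CosetsMeetTraceZero secantBase
  secantBase-cosets (m2 p q r s) (invertible dT) with p ≟ 0# | s ≟ 0#
  ... | no p≢0 | no s≢0 = diagonal-coset p≢0 s≢0
  ... | yes p≡0 | _ = antidiagonal-coset (trans (cong (_* s) p≡0) (zeroˡ s)) dT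
  ... | no _ | yes s≡0 = antidiagonal-coset (trans (cong (p *_) s≡0) (zeroʳ p)) dT

  Irreducible : Carrier → Carrier → Set
  Irreducible B C = ∀ ξ → ξ * ξ + B * ξ + C ≢ 0#

  module NormForm {B C : Carrier} (irreducible : Irreducible B C) where
    N : V3
    N = v3 B 1# C

    -- N is the norm form of F[θ]/(θ² + B θ + C), and S x y rescales it by the norm det (S x y) of x + y θ.
    S : Carrier → Carrier → M2
    S x y = m2 x (C * y) (- y) (x + - (B * y))

    N·S : ∀ x y → N · S x y ≡ scale (det (S x y)) N
    N·S x y = form-injective λ s t → begin
      form (N · S x y) s t
        ≡⟨ form-· N x (C * y) (- y) (x + - (B * y)) s t ⟩
      form N (x * s + C * y * t) (- y * s + (x + - (B * y)) * t)
        ≡⟨ solve 6 (λ x y B C s t →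
             B :* ((x :* s :+ C :* y :* t) :* (:- y :* s :+ (x :- B :* y) :* t))
               :+ :1 :* ((x :* s :+ C :* y :* t) :* (x :* s :+ C :* y :* t))
               :+ C :* ((:- y :* s :+ (x :- B :* y) :* t) :* (:- y :* s :+ (x :- B :* y) :* t))
             := (x :* (x :- B :* y) :- C :* y :* :- y) :* (B :* (s :* t) :+ :1 :* (s :* s) :+ C :* (t :* t)))
             refl x y B C s t ⟩
      det (S x y) * form N s t
        ≡⟨ form-scale (det (S x y)) N s t ⟨
      form (scale (det (S x y)) N) s t ∎
      where open ≡-Reasoning

    det-S≢0-nonzero-y : ∀ {x y} → y ≢ 0# → det (S x y) ≢ 0#
    det-S≢0-nonzero-y {x} {y} y≢0 det≡0 = irreducible (- X) (begin
      - X * - X + B * - X + C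
        ≡⟨ solve 3 (λ X B C → :- X :* :- X :+ B :* :- X :+ C := X :* X :- B :* X :* :1 :+ C :* (:1 :* :1)) refl X B C ⟩
      X * X + - (B * X * 1#) + C * (1# * 1#)
        ≡⟨ cong (λ t → X * X + - (B * X * t) + C * (t * t)) (*-inverseʳ y≢0) ⟨
      X * X + - (B * X * (y * y⁻¹)) + C * ((y * y⁻¹) * (y * y⁻¹))
        ≡⟨ solve 5 (λ x y y' B C → x :* y' :* (x :* y') :- B :* (x :* y') :* (y :* y') :+ C :* ((y :* y') :* (y :* y'))
             := (x :* (x :- B :* y) :- C :* y :* :- y) :* (y' :* y')) refl x y y⁻¹ B C ⟩
      det (S x y) * (y⁻¹ * y⁻¹)
        ≡⟨ cong (_* (y⁻¹ * y⁻¹)) det≡0 ⟩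
      0# * (y⁻¹ * y⁻¹)
        ≡⟨ zeroˡ _ ⟩
      0# ∎)
      where
      open ≡-Reasoning
      y⁻¹ X : Carrier
      y⁻¹ = y≢0 ⁻¹
      X = x * y⁻¹

    det-S≢0-zero-y : ∀ {x} → x ≢ 0# → det (S x 0#) ≢ 0#
    det-S≢0-zero-y {x} x≢0 = subst (_≢ 0#)
      (solve 3 (λ x B C → x :* x := x :* (x :- B :* :0) :- C :* :0 :* :- :0) refl x B C) (*-≢0 x≢0 x≢0)

    det-S≢0 : ∀ {x y} → x ≢ 0# ⊎ y ≢ 0# → det (S x y) ≢ 0#
    det-S≢0 {x} {y} nontrivial with y ≟ 0# | nontrivial
    ... | no y≢0 | _ = det-S≢0-nonzero-y y≢0
    ... | yes refl | inj₁ x≢0 = det-S≢0-zero-y x≢0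
    ... | yes refl | inj₂ y≢0 = ⊥-elim (y≢0 refl)

    cosets : CosetsMeetTraceZero N
    cosets (m2 p q r s) _ =
      let (x , y , nontrivial , x[p+s]+yK≡0) = nontrivial-solution (p + s) (- q + C * r + - (B * s))
      in S x y ,
         (invertible (det-S≢0 nontrivial) , ∼-from-scale (det-S≢0 nontrivial) (N·S x y)) ,
         trans (solve 8 (λ p q r s x y B C →
                 p :* x :+ q :* :- y :+ (r :* (C :* y) :+ s :* (x :- B :* y))
                 := x :* (p :+ s) :+ y :* (:- q :+ C :* r :- B :* s)) refl p q r s x y B C)
               x[p+s]+yK≡0

module ConicLines {q : ℕ} (F : FiniteField q) where
  open FieldProperties F
  open Plane F
  open Projective F
  open BaseLines F

  form-affine : ∀ u ξ l → dot u (scale l (v3 ξ (ξ * ξ) 1#)) ≡ l * form u ξ 1#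
  form-affine (v3 u₁ u₂ u₃) ξ l = solve 5 (λ u₁ u₂ u₃ ξ l →
    u₁ :* (l :* ξ) :+ u₂ :* (l :* (ξ :* ξ)) :+ u₃ :* (l :* :1)
      := l :* (u₁ :* (ξ :* :1) :+ u₂ :* (ξ :* ξ) :+ u₃ :* (:1 :* :1))) refl u₁ u₂ u₃ ξ l

  form-infinite : ∀ u l → dot u (scale l (v3 0# 1# 0#)) ≡ l * form u 1# 0#
  form-infinite (v3 u₁ u₂ u₃) l = solve 4 (λ u₁ u₂ u₃ l →
    u₁ :* (l :* :0) :+ u₂ :* (l :* :1) :+ u₃ :* (l :* :0)
      := l :* (u₁ :* (:1 :* :0) :+ u₂ :* (:1 :* :1) :+ u₃ :* (:0 :* :0))) refl u₁ u₂ u₃ l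

  -- Conic points are (ξ, ξ², 1) = conicPoint ξ 1 and (0, 1, 0) = conicPoint 1 0, up to scalars.
  parameterₛ parameterₜ : ∀ {x} → InConic x → Carrier
  parameterₛ (inj₁ (ξ , _)) = ξ
  parameterₛ (inj₂ _) = 1#
  parameterₜ (inj₁ _) = 1#
  parameterₜ (inj₂ _) = 0#

  incident⇒form≡0 : ∀ {u x} (c : InConic x) → Incident u x → form u (parameterₛ c) (parameterₜ c) ≡ 0#
  incident⇒form≡0 {u} (inj₁ (ξ , l , l≢0 , refl)) ux≡0 = *≡0-cancelˡ l≢0 (trans (sym (form-affine u ξ l)) ux≡0)
  incident⇒form≡0 {u} (inj₂ (l , l≢0 , refl)) ux≡0 = *≡0-cancelˡ l≢0 (trans (sym (form-infinite u l)) ux≡0)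

  scale-∼-scale : ∀ {k l} w → k ≢ 0# → l ≢ 0# → scale k w ∼ scale l w
  scale-∼-scale w k≢0 l≢0 = ∼-trans (∼-sym (scale-∼ w k≢0)) (scale-∼ w l≢0)

  distinct⇒det≢0 : ∀ {x y} (cx : InConic x) (cy : InConic y) → ¬ x ∼ y →
    det (m2 (parameterₛ cy) (parameterₛ cx) (parameterₜ cy) (parameterₜ cx)) ≢ 0#
  distinct⇒det≢0 (inj₁ (ξ , k , k≢0 , refl)) (inj₁ (η , l , l≢0 , refl)) x≁y det≡0 =
    x≁y (subst (λ ζ → scale k (v3 ξ (ξ * ξ) 1#) ∼ scale l (v3 ζ (ζ * ζ) 1#)) ξ≡η (scale-∼-scale _ k≢0 l≢0))
    where
    ξ≡η : ξ ≡ η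
    ξ≡η = sym (x-y≡0⇒x≡y (trans (solve 2 (λ η ξ → η :- ξ := η :* :1 :- ξ :* :1) refl η ξ) det≡0))
  distinct⇒det≢0 (inj₁ (ξ , _)) (inj₂ _) _ det≡0 =
    1≢0 (trans (solve 1 (λ ξ → :1 := :1 :* :1 :- ξ :* :0) refl ξ) det≡0)
  distinct⇒det≢0 (inj₂ _) (inj₁ (η , _)) _ det≡0 =
    -‿≢0 1≢0 (trans (solve 1 (λ η → :- :1 := η :* :0 :- :1 :* :1) refl η) det≡0)
  distinct⇒det≢0 (inj₂ (k , k≢0 , refl)) (inj₂ (l , l≢0 , refl)) x≁y _ = x≁y (scale-∼-scale _ k≢0 l≢0)

  nonzero-∼ : ∀ {u v} → NonZero u → u ∼ v → NonZero v
  nonzero-∼ {v3 u₁ u₂ u₃} u≢0 (k , k≢0 , refl) (ku₁≡0 , ku₂≡0 , ku₃≡0) =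
    u≢0 (*≡0-cancelˡ k≢0 ku₁≡0 , *≡0-cancelˡ k≢0 ku₂≡0 , *≡0-cancelˡ k≢0 ku₃≡0)

  ·-nonzero : ∀ {u A} → Invertible A → NonZero u → NonZero (u · A)
  ·-nonzero {u} {A} dA u≢0 (z₁ , z₂ , z₃) = nonzero-∼ u≢0 (·-∙-adj u dA)
    (trans (cong c₁ w≡0w) (zeroˡ _) , trans (cong c₂ w≡0w) (zeroˡ _) , trans (cong c₃ w≡0w) (zeroˡ _))
    where
    w : V3
    w = (u · A) · adj A
    w≡0w : w ≡ scale 0# w
    w≡0w = trans (cong (_· adj A) (v3-cong (trans z₁ (sym (zeroˡ _))) (trans z₂ (sym (zeroˡ _))) (trans z₃ (sym (zeroˡ _)))))
      (·-scale 0# (u · A) (adj A))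

  secant-inOrbit : ∀ {u} → Secant u → InOrbit secantBase u
  secant-inOrbit {u} (u≢0 , x , y , _ , _ , cx , cy , ux≡0 , uy≡0 , x≁y , _) =
    inOrbit-of-preimage dA (subst (λ w → secantBase ∼ w) (sym u·A≡αN) (scale-∼ secantBase α≢0))
    where
    A : M2
    A = m2 (parameterₛ cy) (parameterₛ cx) (parameterₜ cy) (parameterₜ cx)
    dA : Invertible A
    dA = invertible (distinct⇒det≢0 cx cy x≁y)
    α : Carrier
    α = c₁ (u · A)
    u·A≡ : u · A ≡ v3 α 0# 0#
    u·A≡ = cong₂ (v3 α) (trans (cong c₂ (·-unfold u _ _ _ _)) (incident⇒form≡0 cy uy≡0))
                        (trans (cong c₃ (·-unfold u _ _ _ _)) (incident⇒form≡0 cx ux≡0))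
    u·A≡αN : u · A ≡ scale α secantBase
    u·A≡αN = trans u·A≡ (v3-cong (sym (*-identityʳ α)) (sym (zeroʳ α)) (sym (zeroʳ α)))
    α≢0 : α ≢ 0#
    α≢0 α≡0 = ·-nonzero dA u≢0 (α≡0 , cong c₂ u·A≡ , cong c₃ u·A≡)

  secants-shareOrbit : ∀ {u v} → Secant u → Secant v → SharedOrbit u v
  secants-shareOrbit secant-u secant-v = secantBase , secantBase-cosets , secant-inOrbit secant-u , secant-inOrbit secant-v

  Anisotropic : V3 → Set
  Anisotropic w = ∀ s t → s ≢ 0# ⊎ t ≢ 0# → form w s t ≢ 0#

  exterior-misses-affine : ∀ {u} → Exterior u → ∀ ξ → form u ξ 1# ≢ 0#
  exterior-misses-affine {u} (_ , misses) ξ form≡0 = misses (v3 ξ (ξ * ξ) 1#) (λ (_ , _ , 1≡0) → 1≢0 1≡0)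
    (inj₁ (ξ , 1# , 1≢0 , sym (scale-one _)))
    (trans (cong (dot u) (sym (scale-one _))) (trans (form-affine u ξ 1#) (trans (cong (1# *_) form≡0) (zeroʳ 1#))))

  exterior-misses-infinite : ∀ {u} → Exterior u → form u 1# 0# ≢ 0#
  exterior-misses-infinite {u} (_ , misses) form≡0 = misses (v3 0# 1# 0#) (λ (_ , 1≡0 , _) → 1≢0 1≡0)
    (inj₂ (1# , 1≢0 , sym (scale-one _)))
    (trans (cong (dot u) (sym (scale-one _))) (trans (form-infinite u 1#) (trans (cong (1# *_) form≡0) (zeroʳ 1#))))

  form-dehomogenise : ∀ w s {t} (t≢0 : t ≢ 0#) → form w s t ≡ t * t * form w (s * t≢0 ⁻¹) 1#
  form-dehomogenise w s {t} t≢0 = trans (cong₂ (form w) (sym t[s/t]≡s) (sym (*-identityʳ t))) (form-homogeneous w t _ 1#)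
    where
    t[s/t]≡s : t * (s * t≢0 ⁻¹) ≡ s
    t[s/t]≡s = trans (solve 3 (λ t s t' → t :* (s :* t') := s :* (t :* t')) refl t s (t≢0 ⁻¹))
                     (trans (cong (s *_) (*-inverseʳ t≢0)) (*-identityʳ s))

  form-at-infinity : ∀ w s → form w s 0# ≡ s * s * form w 1# 0#
  form-at-infinity w s = trans (cong₂ (form w) (sym (*-identityʳ s)) (sym (zeroʳ s))) (form-homogeneous w s 1# 0#)

  exterior⇒anisotropic : ∀ {u} → Exterior u → Anisotropic u
  exterior⇒anisotropic {u} ext s t nontrivial with t ≟ 0# | nontrivial
  ... | no t≢0 | _ = λ form≡0 → exterior-misses-affine ext (s * t≢0 ⁻¹)
    (*≡0-cancelˡ (*-≢0 t≢0 t≢0) (trans (sym (form-dehomogenise u s t≢0)) form≡0))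
  ... | yes refl | inj₁ s≢0 = λ form≡0 → exterior-misses-infinite ext
    (*≡0-cancelˡ (*-≢0 s≢0 s≢0) (trans (sym (form-at-infinity u s)) form≡0))
  ... | yes refl | inj₂ t≢0 = ⊥-elim (t≢0 refl)

  adj-nontrivial : ∀ {a b c d s t} → det (m2 a b c d) ≢ 0# → s ≢ 0# ⊎ t ≢ 0# →
    d * s + - b * t ≢ 0# ⊎ - c * s + a * t ≢ 0#
  adj-nontrivial {a} {b} {c} {d} {s} {t} det≢0 nontrivial with d * s + - b * t ≟ 0# | - c * s + a * t ≟ 0#
  ... | no s'≢0 | _ = inj₁ s'≢0
  ... | yes _ | no t'≢0 = inj₂ t'≢0
  ... | yes s'≡0 | yes t'≡0 with nontrivial
  ...   | inj₁ s≢0 = ⊥-elim (*-≢0 det≢0 s≢0 (begin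
    (a * d + - (b * c)) * s             ≡⟨ solve 6 (λ a b c d s t → (a :* d :- b :* c) :* s
                                             := a :* (d :* s :+ :- b :* t) :+ b :* (:- c :* s :+ a :* t)) refl a b c d s t ⟩
    a * (d * s + - b * t) + b * (- c * s + a * t) ≡⟨ cong₂ (λ x y → a * x + b * y) s'≡0 t'≡0 ⟩
    a * 0# + b * 0#                     ≡⟨ solve 2 (λ a b → a :* :0 :+ b :* :0 := :0) refl a b ⟩
    0#                                  ∎))
    where open ≡-Reasoning
  ...   | inj₂ t≢0 = ⊥-elim (*-≢0 det≢0 t≢0 (begin
    (a * d + - (b * c)) * t             ≡⟨ solve 6 (λ a b c d s t → (a :* d :- b :* c) :* t
                                             := c :* (d :* s :+ :- b :* t) :+ d :* (:- c :* s :+ a :* t)) refl a b c d s t ⟩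
    c * (d * s + - b * t) + d * (- c * s + a * t) ≡⟨ cong₂ (λ x y → c * x + d * y) s'≡0 t'≡0 ⟩
    c * 0# + d * 0#                     ≡⟨ solve 2 (λ c d → c :* :0 :+ d :* :0 := :0) refl c d ⟩
    0#                                  ∎))
    where open ≡-Reasoning

  anisotropic-pullback : ∀ {N u B} → Anisotropic u → Invertible B → N · B ∼ u → Anisotropic N
  anisotropic-pullback {N} {u} {B@(m2 a b c d)} aniso (invertible det≢0) (k , k≢0 , u≡k[NB]) s t nontrivial formN≡0 =
    aniso s' t' (adj-nontrivial det≢0 nontrivial) (begin
      form u s' t'                          ≡⟨ cong (λ w → form w s' t') u≡k[NB] ⟩
      form (scale k (N · B)) s' t'          ≡⟨ form-scale k (N · B) s' t' ⟩
      k * form (N · B) s' t'                ≡⟨ cong (k *_) (form-· N a b c d s' t') ⟩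
      k * form N (a * s' + b * t') (c * s' + d * t')
        ≡⟨ cong (λ e → k * e) (cong₂ (form N) (solve 6 (λ a b c d s t →
             a :* (d :* s :+ :- b :* t) :+ b :* (:- c :* s :+ a :* t) := (a :* d :- b :* c) :* s) refl a b c d s t)
           (solve 6 (λ a b c d s t →
             c :* (d :* s :+ :- b :* t) :+ d :* (:- c :* s :+ a :* t) := (a :* d :- b :* c) :* t) refl a b c d s t)) ⟩
      k * form N (det B * s) (det B * t)    ≡⟨ cong (k *_) (form-homogeneous N (det B) s t) ⟩
      k * (det B * det B * form N s t)      ≡⟨ cong (λ e → k * (det B * det B * e)) formN≡0 ⟩
      k * (det B * det B * 0#)              ≡⟨ solve 2 (λ k δ → k :* (δ :* δ :* :0) := :0) refl k (det B) ⟩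
      0#                                    ∎)
    where
    open ≡-Reasoning
    s' t' : Carrier
    s' = d * s + - b * t
    t' = - c * s + a * t

  anisotropic⇒irreducible : ∀ {B C} → Anisotropic (v3 B 1# C) → Irreducible B C
  anisotropic⇒irreducible {B} {C} aniso ξ root = aniso ξ 1# (inj₂ 1≢0)
    (trans (solve 3 (λ B C ξ → B :* (ξ :* :1) :+ :1 :* (ξ :* ξ) :+ C :* (:1 :* :1) := ξ :* ξ :+ B :* ξ :+ C) refl B C ξ) root)

  exterior-u₂≢0 : ∀ {u₁ u₂ u₃} → Exterior (v3 u₁ u₂ u₃) → u₂ ≢ 0#
  exterior-u₂≢0 {u₁} {u₂} {u₃} ext = subst (_≢ 0#)
    (solve 3 (λ u₁ u₂ u₃ → u₁ :* (:1 :* :0) :+ u₂ :* (:1 :* :1) :+ u₃ :* (:0 :* :0) := u₂) refl u₁ u₂ u₃)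
    (exterior-misses-infinite ext)

  module OddCharacteristic (two≢0 : two ≢ 0#) where
    discriminant : V3 → Carrier
    discriminant (v3 u₁ u₂ u₃) = u₁ * u₁ + - (two * two * u₂ * u₃)

    normalForm : Carrier → V3
    normalForm d = v3 0# 1# (- d)

    -- Completing the square: 4 u₂ (u₁ s t + u₂ s² + u₃ t²) = (2 u₂ s + u₁ t)² - Δ t².
    normalForm-· : ∀ u₁ u₂ u₃ →
      normalForm (discriminant (v3 u₁ u₂ u₃)) · m2 (two * u₂) u₁ 0# 1# ≡ scale (two * two * u₂) (v3 u₁ u₂ u₃)
    normalForm-· u₁ u₂ u₃ = form-injective λ s t → begin
      form (normalForm (discriminant u) · m2 (two * u₂) u₁ 0# 1#) s t
        ≡⟨ form-· (normalForm (discriminant u)) (two * u₂) u₁ 0# 1# s t ⟩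
      form (normalForm (discriminant u)) (two * u₂ * s + u₁ * t) (0# * s + 1# * t)
        ≡⟨ solve 5 (λ u₁ u₂ u₃ s t →
             :0 :* ((:2 :* u₂ :* s :+ u₁ :* t) :* (:0 :* s :+ :1 :* t))
               :+ :1 :* ((:2 :* u₂ :* s :+ u₁ :* t) :* (:2 :* u₂ :* s :+ u₁ :* t))
               :+ :- (u₁ :* u₁ :- :2 :* :2 :* u₂ :* u₃) :* ((:0 :* s :+ :1 :* t) :* (:0 :* s :+ :1 :* t))
             := :2 :* :2 :* u₂ :* (u₁ :* (s :* t) :+ u₂ :* (s :* s) :+ u₃ :* (t :* t))) refl u₁ u₂ u₃ s t ⟩
      two * two * u₂ * form u s t
        ≡⟨ form-scale (two * two * u₂) u s t ⟨
      form (scale (two * two * u₂) u) s t ∎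
      where
      open ≡-Reasoning
      u : V3
      u = v3 u₁ u₂ u₃

    exterior-inOrbit : ∀ {u} → Exterior u → InOrbit (normalForm (discriminant u)) u
    exterior-inOrbit {u@(v3 u₁ u₂ u₃)} ext =
      m2 (two * u₂) u₁ 0# 1# ,
      upperTriangular-invertible (*-≢0 two≢0 u₂≢0) 1≢0 ,
      ∼-from-scale (*-≢0 (*-≢0 two≢0 two≢0) u₂≢0) (normalForm-· u₁ u₂ u₃)
      where
      u₂≢0 : u₂ ≢ 0#
      u₂≢0 = exterior-u₂≢0 ext

    normalForm-anisotropic : ∀ {u} → Exterior u → Anisotropic (normalForm (discriminant u))
    normalForm-anisotropic ext =
      let (B , dB , NB∼u) = exterior-inOrbit ext
      in anisotropic-pullback (exterior⇒anisotropic ext) dB NB∼u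

    exterior⇒nonsquare : ∀ {u} → Exterior u → ¬ Square (discriminant u)
    exterior⇒nonsquare {u} ext (w , w²≡Δ) =
      anisotropic⇒irreducible (normalForm-anisotropic ext) w
           (trans (solve 2 (λ w Δ → w :* w :+ :0 :* w :+ :- Δ := w :* w :- Δ) refl w (discriminant u))
             (trans (cong (λ e → e + - discriminant u) w²≡Δ) (-‿inverseʳ _)))

    normalForm-inOrbit : ∀ {d₁ d₂} → ¬ Square d₁ → ¬ Square d₂ → InOrbit (normalForm d₁) (normalForm d₂)
    normalForm-inOrbit {d₁} {d₂} ¬□d₁ ¬□d₂ =
      let (m , m²≡d₁d₂) = nonsquare*nonsquare ¬□d₁ ¬□d₂
          m≢0 : m ≢ 0#
          m≢0 m≡0 = *-≢0 (nonsquare≢0 ¬□d₁) (nonsquare≢0 ¬□d₂)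
            (trans (sym m²≡d₁d₂) (trans (cong (_* m) m≡0) (zeroˡ m)))
      in m2 m 0# 0# d₂ ,
         upperTriangular-invertible m≢0 (nonsquare≢0 ¬□d₂) ,
         ∼-from-scale (*-≢0 m≢0 m≢0) (form-injective λ s t → begin
           form (normalForm d₁ · m2 m 0# 0# d₂) s t
             ≡⟨ form-· (normalForm d₁) m 0# 0# d₂ s t ⟩
           form (normalForm d₁) (m * s + 0# * t) (0# * s + d₂ * t)
             ≡⟨ solve 5 (λ m d₁ d₂ s t →
                  :0 :* ((m :* s :+ :0 :* t) :* (:0 :* s :+ d₂ :* t)) :+ :1 :* ((m :* s :+ :0 :* t) :* (m :* s :+ :0 :* t))
                    :+ :- d₁ :* ((:0 :* s :+ d₂ :* t) :* (:0 :* s :+ d₂ :* t))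
                  := m :* m :* (s :* s) :- d₁ :* d₂ :* (d₂ :* (t :* t))) refl m d₁ d₂ s t ⟩
           m * m * (s * s) + - (d₁ * d₂ * (d₂ * (t * t)))
             ≡⟨ cong (λ e → m * m * (s * s) + - (e * (d₂ * (t * t)))) m²≡d₁d₂ ⟨
           m * m * (s * s) + - (m * m * (d₂ * (t * t)))
             ≡⟨ solve 4 (λ m d s t → m :* m :* (s :* s) :- m :* m :* (d :* (t :* t))
                  := m :* m :* (:0 :* (s :* t) :+ :1 :* (s :* s) :+ :- d :* (t :* t))) refl m d₂ s t ⟩
           m * m * form (normalForm d₂) s t
             ≡⟨ form-scale (m * m) (normalForm d₂) s t ⟨
           form (scale (m * m) (normalForm d₂)) s t ∎)
      where open ≡-Reasoning

    exteriors-shareOrbit : ∀ {u v} → Exterior u → Exterior v → SharedOrbit u v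
    exteriors-shareOrbit {u} {v} ext-u ext-v =
      normalForm (discriminant u) ,
      NormForm.cosets (anisotropic⇒irreducible (normalForm-anisotropic ext-u)) ,
      exterior-inOrbit ext-u ,
      inOrbit-trans (normalForm-inOrbit (exterior⇒nonsquare ext-u) (exterior⇒nonsquare ext-v)) (exterior-inOrbit ext-v)

  module EvenCharacteristic (two≡0 : two ≡ 0#) where
    open Characteristic2 two≡0

    normalForm : Carrier → V3
    normalForm c = v3 1# 1# c

    exterior-u₁≢0 : ∀ {u₁ u₂ u₃} → Exterior (v3 u₁ u₂ u₃) → u₁ ≢ 0#
    exterior-u₁≢0 {u₁} {u₂} {u₃} ext u₁≡0 =
      let (w , w²≡u₂u₃) = every-square (u₂ * u₃)
      in exterior⇒anisotropic ext w u₂ (inj₂ (exterior-u₂≢0 ext)) (begin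
        u₁ * (w * u₂) + u₂ * (w * w) + u₃ * (u₂ * u₂)    ≡⟨ cong₂ (λ a b → a * (w * u₂) + u₂ * b + u₃ * (u₂ * u₂)) u₁≡0 w²≡u₂u₃ ⟩
        0# * (w * u₂) + u₂ * (u₂ * u₃) + u₃ * (u₂ * u₂)  ≡⟨ solve 3 (λ w u₂ u₃ → :0 :* (w :* u₂) :+ u₂ :* (u₂ :* u₃) :+ u₃ :* (u₂ :* u₂)
                                                               := :2 :* (u₂ :* u₂ :* u₃)) refl w u₂ u₃ ⟩
        two * (u₂ * u₂ * u₃)                              ≡⟨ two*≡0 _ ⟩
        0#                                                ∎)
      where open ≡-Reasoning

    invariant : ∀ u → Exterior u → Carrier
    invariant (v3 u₁ u₂ u₃) ext = u₂ * u₃ * (exterior-u₁≢0 ext ⁻¹ * exterior-u₁≢0 ext ⁻¹)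

    exterior-inOrbit : ∀ {u} (ext : Exterior u) → InOrbit (normalForm (invariant u ext)) u
    exterior-inOrbit {u@(v3 u₁ u₂ u₃)} ext =
      m2 (u₁ * u₂) 0# 0# (u₁ * u₁) ,
      upperTriangular-invertible (*-≢0 u₁≢0 u₂≢0) (*-≢0 u₁≢0 u₁≢0) ,
      ∼-from-scale (*-≢0 (*-≢0 u₁≢0 u₁≢0) u₂≢0) (form-injective λ s t → begin
        form (normalForm c · m2 (u₁ * u₂) 0# 0# (u₁ * u₁)) s t
          ≡⟨ form-· (normalForm c) (u₁ * u₂) 0# 0# (u₁ * u₁) s t ⟩
        form (normalForm c) (u₁ * u₂ * s + 0# * t) (0# * s + u₁ * u₁ * t)
          ≡⟨ solve 6 (λ u₁ u₂ u₃ i s t →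
               :1 :* ((u₁ :* u₂ :* s :+ :0 :* t) :* (:0 :* s :+ u₁ :* u₁ :* t))
                 :+ :1 :* ((u₁ :* u₂ :* s :+ :0 :* t) :* (u₁ :* u₂ :* s :+ :0 :* t))
                 :+ u₂ :* u₃ :* (i :* i) :* ((:0 :* s :+ u₁ :* u₁ :* t) :* (:0 :* s :+ u₁ :* u₁ :* t))
               := u₁ :* u₁ :* u₂ :* (u₁ :* (s :* t) :+ u₂ :* (s :* s)) :+ u₁ :* u₁ :* u₂ :* u₃ :* (t :* t) :* ((u₁ :* i) :* (u₁ :* i)))
               refl u₁ u₂ u₃ u₁⁻¹ s t ⟩
        u₁ * u₁ * u₂ * (u₁ * (s * t) + u₂ * (s * s)) + u₁ * u₁ * u₂ * u₃ * (t * t) * ((u₁ * u₁⁻¹) * (u₁ * u₁⁻¹))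
          ≡⟨ cong (λ e → u₁ * u₁ * u₂ * (u₁ * (s * t) + u₂ * (s * s)) + u₁ * u₁ * u₂ * u₃ * (t * t) * (e * e)) (*-inverseʳ u₁≢0) ⟩
        u₁ * u₁ * u₂ * (u₁ * (s * t) + u₂ * (s * s)) + u₁ * u₁ * u₂ * u₃ * (t * t) * (1# * 1#)
          ≡⟨ solve 5 (λ u₁ u₂ u₃ s t → u₁ :* u₁ :* u₂ :* (u₁ :* (s :* t) :+ u₂ :* (s :* s)) :+ u₁ :* u₁ :* u₂ :* u₃ :* (t :* t) :* (:1 :* :1)
               := u₁ :* u₁ :* u₂ :* (u₁ :* (s :* t) :+ u₂ :* (s :* s) :+ u₃ :* (t :* t))) refl u₁ u₂ u₃ s t ⟩
        u₁ * u₁ * u₂ * form u s t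
          ≡⟨ form-scale (u₁ * u₁ * u₂) u s t ⟨
        form (scale (u₁ * u₁ * u₂) u) s t ∎)
      where
      open ≡-Reasoning
      u₁≢0 : u₁ ≢ 0#
      u₁≢0 = exterior-u₁≢0 ext
      u₂≢0 : u₂ ≢ 0#
      u₂≢0 = exterior-u₂≢0 ext
      u₁⁻¹ c : Carrier
      u₁⁻¹ = u₁≢0 ⁻¹
      c = invariant u ext

    normalForm-anisotropic : ∀ {u} (ext : Exterior u) → Anisotropic (normalForm (invariant u ext))
    normalForm-anisotropic ext =
      let (B , dB , NB∼u) = exterior-inOrbit ext
      in anisotropic-pullback (exterior⇒anisotropic ext) dB NB∼u

    exterior⇒¬artinSchreier : ∀ {u} (ext : Exterior u) → ¬ ArtinSchreier (invariant u ext)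
    exterior⇒¬artinSchreier {u} ext (z , z²+z≡c) = anisotropic⇒irreducible (normalForm-anisotropic ext) z (begin
      z * z + 1# * z + c   ≡⟨ solve 2 (λ z c → z :* z :+ :1 :* z :+ c := (z :* z :+ z) :+ c) refl z c ⟩
      (z * z + z) + c      ≡⟨ cong (_+ c) z²+z≡c ⟩
      c + c                ≡⟨ solve 1 (λ c → c :+ c := :2 :* c) refl c ⟩
      two * c              ≡⟨ two*≡0 c ⟩
      0#                   ∎)
      where
      open ≡-Reasoning
      c : Carrier
      c = invariant u ext

    normalForm-inOrbit : ∀ {c₁ c₂} → ¬ ArtinSchreier c₁ → ¬ ArtinSchreier c₂ → InOrbit (normalForm c₁) (normalForm c₂)
    normalForm-inOrbit {c₁} {c₂} ¬c₁ ¬c₂ =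
      let (w , w²+w≡c₁+c₂) = ¬artinSchreier+¬artinSchreier ¬c₁ ¬c₂
      in m2 1# w 0# 1# ,
         upperTriangular-invertible 1≢0 1≢0 ,
         subst (normalForm c₁ · m2 1# w 0# 1# ∼_) (form-injective λ s t → begin
           form (normalForm c₁ · m2 1# w 0# 1#) s t
             ≡⟨ form-· (normalForm c₁) 1# w 0# 1# s t ⟩
           form (normalForm c₁) (1# * s + w * t) (0# * s + 1# * t)
             ≡⟨ solve 5 (λ w c₁ c₂ s t →
                  :1 :* ((:1 :* s :+ w :* t) :* (:0 :* s :+ :1 :* t)) :+ :1 :* ((:1 :* s :+ w :* t) :* (:1 :* s :+ w :* t))
                    :+ c₁ :* ((:0 :* s :+ :1 :* t) :* (:0 :* s :+ :1 :* t))
                  := :1 :* (s :* t) :+ :1 :* (s :* s) :+ c₂ :* (t :* t)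
                    :+ (w :* w :+ w :- (c₁ :+ c₂)) :* (t :* t) :+ :2 :* (w :* (s :* t) :+ c₁ :* (t :* t))) refl w c₁ c₂ s t ⟩
           form (normalForm c₂) s t + (w * w + w + - (c₁ + c₂)) * (t * t) + two * (w * (s * t) + c₁ * (t * t))
             ≡⟨ cong₂ (λ x y → form (normalForm c₂) s t + x * (t * t) + y)
                  (trans (cong (λ e → e + - (c₁ + c₂)) w²+w≡c₁+c₂) (-‿inverseʳ _)) (two*≡0 _) ⟩
           form (normalForm c₂) s t + 0# * (t * t) + 0#
             ≡⟨ solve 2 (λ f t → f :+ :0 :* (t :* t) :+ :0 := f) refl (form (normalForm c₂) s t) t ⟩
           form (normalForm c₂) s t ∎) ∼-refl
      where open ≡-Reasoning

    exteriors-shareOrbit : ∀ {u v} → Exterior u → Exterior v → SharedOrbit u v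
    exteriors-shareOrbit {u} {v} ext-u ext-v =
      normalForm (invariant u ext-u) ,
      NormForm.cosets (anisotropic⇒irreducible (normalForm-anisotropic ext-u)) ,
      exterior-inOrbit ext-u ,
      inOrbit-trans (normalForm-inOrbit (exterior⇒¬artinSchreier ext-u) (exterior⇒¬artinSchreier ext-v)) (exterior-inOrbit ext-v)

  exteriors-shareOrbit : ∀ {u v} → Exterior u → Exterior v → SharedOrbit u v
  exteriors-shareOrbit with two ≟ 0#
  ... | yes two≡0 = EvenCharacteristic.exteriors-shareOrbit two≡0
  ... | no two≢0 = OddCharacteristic.exteriors-shareOrbit two≢0

mainTheorem4 : (q : ℕ) → IsPrimePower q → (F : FiniteField q) →
    Plane.GenerouslyTransitiveOnLines F (Plane.Secant F)
      × Plane.GenerouslyTransitiveOnLines F (Plane.Exterior F)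
mainTheorem4 q _ F = generouslyTransitive secants-shareOrbit , generouslyTransitive exteriors-shareOrbit
  where
  open Projective F
  open ConicLines F
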